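{- Let $r\in\mathbb N$ and $n\in\mathbb N_0$. Let $\mathcal P_e(n,2r)$ (resp. $\mathcal P_o(n,2r)$) be the set of partitions of $n$ in which the number of parts divisible by $2r$ (with multiplicity) is even (resp. odd), and let $\mathcal Q_o(n,r)$ be the set of partitions of $n$ with no part divisible by $2r$ and whose parts divisible by $r$ are distinct. Then \[ \sum_{\lambda\in\mathcal P_e(n,2r)}\ell(\lambda)-\sum_{\lambda\in\mathcal P_o(n,2r)}\ell(\lambda)-\sum_{\lambda\in\mathcal Q_o(n,r)}\ell(\lambda) \] equals the number of pairs $(\lambda,(a^b))$ with $a,b$ positive integers such that (i) $2r\mid a$, and (ii) $\lambda\in\mathcal Q_o(n-ab,r)$.
   Context: A partition is a non-increasing sequence of positive integers; the empty partition (of $0$) is allowed for $\lambda$. $(a^b)$ denotes the partition with $b$ parts equal to $a$. $\ell(\lambda)$ denotes the number of parts of $\lambda$ counted with multiplicity. -}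

module Defs where

open import Data.Nat using (ℕ; _+_; _*_; _∸_; _≤_; _<_; _≥_; _≥?_; _%_)
open import Data.Nat.Divisibility using (_∣_; _∣?_)
open import Data.List using (List; length; filter; map)
open import Data.Nat.ListAction using (sum)
open import Data.List.Relation.Unary.All using (All)
open import Data.List.Relation.Unary.Linked using (Linked)
open import Data.List.Relation.Unary.Unique.Propositional using (Unique)
open import Data.List.Membership.Propositional using (_∈_)
open import Data.Product using (_×_; _,_)
open import Relation.Binary.PropositionalEquality using (_≡_)
open import Relation.Nullary using (¬_)

IsPartition : ℕ → List ℕ → Set
IsPartition n xs = Linked _≥_ xs × All (λ x → 1 ≤ x) xs × sum xs ≡ n

ℓ : List ℕ → ℕ
ℓ = length

countDiv : ℕ → List ℕ → ℕ
countDiv d xs = length (filter (d ∣?_) xs)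

Pe : ℕ → ℕ → List ℕ → Set
Pe n r xs = IsPartition n xs × countDiv (2 * r) xs % 2 ≡ 0

Po : ℕ → ℕ → List ℕ → Set
Po n r xs = IsPartition n xs × countDiv (2 * r) xs % 2 ≡ 1

Qo : ℕ → ℕ → List ℕ → Set
Qo n r xs = IsPartition n xs × All (λ x → ¬ (2 * r ∣ x)) xs
          × Unique (filter (r ∣?_) xs)

-- pairs (λ, (a^b)) with a, b ≥ 1, 2r ∣ a, and λ ∈ Q_o(n - ab, r)
-- (ab ≤ n is required so that n - ab is a natural number)
PairSet : ℕ → ℕ → (List ℕ × ℕ × ℕ) → Set
PairSet n r (lam , a , b) =
  1 ≤ a × 1 ≤ b × (2 * r ∣ a) × a * b ≤ n × Qo (n ∸ a * b) r lam

Enumerates : {A : Set} → List A → (A → Set) → Set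
Enumerates {A} L P = Unique L × ((x : A) → (x ∈ L → P x) × (P x → x ∈ L))

sumℓ : List (List ℕ) → ℕ
sumℓ L = sum (map ℓ L)

{-# OPTIONS --safe #-}
module Submission where

-- Write s(k) = -1 if 2r ∣ k and 1 otherwise.  The signed generating function
-- W = ∑_λ (∏ s(parts)) x^|λ| is ∏_k 1/(1 - s(k) xᵏ), and the generating function of Q_o is
-- Q = ∏_{r∤k} 1/(1 - xᵏ) ∏_{k odd multiple of r} (1 + xᵏ).  Multiplying both by
-- ∏_k (1 - s(k) xᵏ) reduces W = Q to Euler's identity ∏_j (1 + yʲ) ∏_{j odd} (1 - yʲ) = 1
-- for y = x²ʳ.  Weighting by length is a logarithmic derivative: L = W ∑_k s(k) xᵏ/(1 - s(k) xᵏ)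
-- and L_Q = Q ∑_k d_k with d_k = xᵏ/(1 - xᵏ), xᵏ/(1 + xᵏ) or 0 according as r ∤ k, k is an
-- odd multiple of r, or 2r ∣ k.  Since xᵏ/(1 - xᵏ) - xᵏ/(1 + xᵏ) = 2x²ᵏ/(1 - x²ᵏ), the two
-- sums differ by ∑_{2r∣a} xᵃ/(1 - xᵃ), so L - L_Q = Q ∑_{2r∣a} ∑_{b≥1} x^(ab), whose
-- coefficient of xⁿ counts the pairs (λ, (aᵇ)).  All series are formal power series over ℤ;
-- infinite products are avoided by using parts ≤ K and comparing coefficients up to x^K.

open import Defs

open import Data.Nat using (ℕ; zero; suc; z≤n; s≤s; _≤_; _<_; _≥_; _+_; _*_; _∸_; _%_; _≤?_; >-nonZero)
open import Data.Nat.ListAction using (sum)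
open import Data.Nat.ListAction.Properties using (sum-↭)
open import Data.Nat.Divisibility
  using (_∣_; _∣?_; *-monoʳ-∣; *-cancelˡ-∣; ∣m+n∣m⇒∣n; m*n∣⇒m∣; m*n∣⇒n∣; ∣⇒≤; n∣n)
import Data.Nat.Properties as ℕ
open import Data.Integer using (ℤ; +_; -_; _-_; 0ℤ; 1ℤ; -1ℤ; _^_)
  renaming (_+_ to _+ℤ_; _*_ to _*ℤ_)
import Data.Integer.Properties as ℤ
open import Data.Integer.Tactic.RingSolver using (solve-∀)
open import Data.List using (List; []; _∷_; _++_; map; length; filter; concatMap; applyDownFrom)
import Data.List.Properties as List
open import Data.List.Relation.Unary.Any using (here; there)
open import Data.List.Relation.Unary.Linked using (Linked; []; [-]; _∷_)
import Data.List.Relation.Unary.Linked as Linked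
open import Data.List.Relation.Unary.Unique.Propositional using (Unique)
open import Data.List.Relation.Unary.AllPairs using ([]; _∷_)
import Data.List.Relation.Unary.Unique.Propositional.Properties as Uniqueₚ
open import Data.List.Membership.Propositional using (_∈_; _∉_; find; lose)
open import Data.List.Membership.Propositional.Properties
  using (∈-++⁻; ∈-++⁺ˡ; ∈-++⁺ʳ; ∈-map⁻; ∈-map⁺; ∈-filter⁻; ∈-filter⁺; ∈-concatMap⁺; ∈-concatMap⁻;
         ∈-applyDownFrom⁺; ∈-applyDownFrom⁻)
open import Data.List.Membership.Propositional.Properties.WithK using (unique∧set⇒bag)
open import Data.List.Relation.Binary.BagAndSetEquality using (∼bag⇒↭)
open import Data.List.Relation.Binary.Permutation.Propositional using (_↭_)
import Data.List.Relation.Binary.Permutation.Propositional.Properties as ↭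
open import Data.List.Relation.Unary.Unique.DecPropositional ℕ._≟_ using (unique?)
open import Data.List.Relation.Unary.All using (All; []; _∷_; all?)
import Data.List.Relation.Unary.All as All
import Data.List.Relation.Unary.All.Properties as Allₚ
open import Data.Product using (_×_; _,_; proj₁; proj₂; ∃)
open import Data.Sum using (_⊎_; inj₁; inj₂)
open import Relation.Binary.PropositionalEquality
open import Function.Bundles using (_⇔_; mk⇔; Equivalence)
open import Relation.Nullary using (¬_; ¬?; Dec; yes; no)
open import Relation.Nullary.Decidable using (_×-dec_)
open import Data.Empty using (⊥-elim)
open import Relation.Binary.Bundles using (Setoid)
import Relation.Binary.Reasoning.Setoid as SetoidReasoning
open import Level using (0ℓ)

-- Formal power series over ℤ

Series : Set
Series = ℕ → ℤ

infix 4 _≈_ _≈[_]_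
_≈_ : Series → Series → Set
a ≈ b = ∀ n → a n ≡ b n

_≈[_]_ : Series → ℕ → Series → Set
a ≈[ M ] b = ∀ n → n ≤ M → a n ≡ b n

≈⇒≈[] : ∀ {a b} M → a ≈ b → a ≈[ M ] b
≈⇒≈[] M e n _ = e n

≈[]⇒≈ : ∀ {a b} → (∀ M → a ≈[ M ] b) → a ≈ b
≈[]⇒≈ e n = e n n ℕ.≤-refl

≈-sym : ∀ {a b} → a ≈ b → b ≈ a
≈-sym e n = sym (e n)

≈-trans : ∀ {a b c} → a ≈ b → b ≈ c → a ≈ c
≈-trans e f n = trans (e n) (f n)

≈[]-sym : ∀ {a b M} → a ≈[ M ] b → b ≈[ M ] a
≈[]-sym e n p = sym (e n p)

≈[]-trans : ∀ {a b c M} → a ≈[ M ] b → b ≈[ M ] c → a ≈[ M ] c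
≈[]-trans e f n p = trans (e n p) (f n p)

≈-setoid : Setoid 0ℓ 0ℓ
≈-setoid = record
  { Carrier = Series ; _≈_ = _≈_
  ; isEquivalence = record { refl = λ n → refl ; sym = ≈-sym ; trans = ≈-trans } }

≈[]-setoid : ℕ → Setoid 0ℓ 0ℓ
≈[]-setoid M = record
  { Carrier = Series ; _≈_ = _≈[ M ]_
  ; isEquivalence = record { refl = λ n p → refl ; sym = ≈[]-sym ; trans = ≈[]-trans } }

module ≈-Reasoning = SetoidReasoning ≈-setoid
module ≈[]-Reasoning M = SetoidReasoning (≈[]-setoid M)

infixl 6 _⊕_ _⊝_
infixl 7 _·_

_⊕_ : Series → Series → Series
(a ⊕ b) n = a n +ℤ b n

_⊝_ : Series → Series → Series
(a ⊝ b) n = a n - b n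

_·_ : ℤ → Series → Series
(c · a) n = c *ℤ a n

𝟘 : Series
𝟘 n = 0ℤ

𝟙 : Series
𝟙 zero = 1ℤ
𝟙 (suc n) = 0ℤ

⊕-cong[] : ∀ {a b a' b' M} → a ≈[ M ] a' → b ≈[ M ] b' → a ⊕ b ≈[ M ] a' ⊕ b'
⊕-cong[] e f n p = cong₂ _+ℤ_ (e n p) (f n p)

⊕-cong : ∀ {a b a' b'} → a ≈ a' → b ≈ b' → a ⊕ b ≈ a' ⊕ b'
⊕-cong e f n = cong₂ _+ℤ_ (e n) (f n)

⊕-congˡ : ∀ {a a'} b → a ≈ a' → a ⊕ b ≈ a' ⊕ b
⊕-congˡ b e n = cong (_+ℤ b n) (e n)

⊕-congʳ : ∀ a {b b'} → b ≈ b' → a ⊕ b ≈ a ⊕ b'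
⊕-congʳ a e n = cong (a n +ℤ_) (e n)

·-cong[] : ∀ {a a' M} c → a ≈[ M ] a' → c · a ≈[ M ] c · a'
·-cong[] c e n p = cong (c *ℤ_) (e n p)

·-cong : ∀ {a a'} c → a ≈ a' → c · a ≈ c · a'
·-cong c e n = cong (c *ℤ_) (e n)

shift : ℕ → Series → Series
shift zero a n = a n
shift (suc k) a zero = 0ℤ
shift (suc k) a (suc n) = shift k a n

shift-< : ∀ k a n → n < k → shift k a n ≡ 0ℤ
shift-< (suc k) a zero p = refl
shift-< (suc k) a (suc n) (s≤s p) = shift-< k a n p

shift-≤ : ∀ k a n → k ≤ n → shift k a n ≡ a (n ∸ k)
shift-≤ zero a n p = refl
shift-≤ (suc k) a (suc n) (s≤s p) = shift-≤ k a n p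

shift-+ : ∀ j k a → shift j (shift k a) ≈ shift (j + k) a
shift-+ zero k a n = refl
shift-+ (suc j) k a zero = refl
shift-+ (suc j) k a (suc n) = shift-+ j k a n

shift-comm : ∀ j k a → shift j (shift k a) ≈ shift k (shift j a)
shift-comm j k a n = begin
  shift j (shift k a) n  ≡⟨ shift-+ j k a n ⟩
  shift (j + k) a n      ≡⟨ cong (λ t → shift t a n) (ℕ.+-comm j k) ⟩
  shift (k + j) a n      ≡⟨ shift-+ k j a n ⟨
  shift k (shift j a) n  ∎
  where open ≡-Reasoning

shift-⊕ : ∀ k a b → shift k (a ⊕ b) ≈ shift k a ⊕ shift k b
shift-⊕ zero a b n = refl
shift-⊕ (suc k) a b zero = refl
shift-⊕ (suc k) a b (suc n) = shift-⊕ k a b n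

shift-· : ∀ k c a → shift k (c · a) ≈ c · shift k a
shift-· zero c a n = refl
shift-· (suc k) c a zero = sym (ℤ.*-zeroʳ c)
shift-· (suc k) c a (suc n) = shift-· k c a n

shift-𝟘 : ∀ k → shift k 𝟘 ≈ 𝟘
shift-𝟘 zero n = refl
shift-𝟘 (suc k) zero = refl
shift-𝟘 (suc k) (suc n) = shift-𝟘 k n

shift-cong[] : ∀ k {a b} M → a ≈[ M ] b → shift k a ≈[ M ] shift k b
shift-cong[] zero M e n p = e n p
shift-cong[] (suc k) M e zero p = refl
shift-cong[] (suc k) (suc M) e (suc n) (s≤s p) =
  shift-cong[] k M (λ i q → e i (ℕ.m≤n⇒m≤1+n q)) n p

shift-cong : ∀ k {a b} → a ≈ b → shift k a ≈ shift k b
shift-cong k e = ≈[]⇒≈ (λ M → shift-cong[] k M (≈⇒≈[] M e))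

shift-suc-cong< : ∀ k a b n → (∀ i → i < n → a i ≡ b i) →
                  shift (suc k) a n ≡ shift (suc k) b n
shift-suc-cong< k a b zero h = refl
shift-suc-cong< k a b (suc n) h = shift-cong[] k n (λ i p → h i (s≤s p)) n ℕ.≤-refl

shift-≈[]𝟘 : ∀ k a M → M < k → shift k a ≈[ M ] 𝟘
shift-≈[]𝟘 k a M lt n p = shift-< k a n (ℕ.≤-<-trans p lt)

mul1+ : ℤ → ℕ → Series → Series
mul1+ c k a = a ⊕ c · shift k a

mul1+-cong[] : ∀ c k {a b} M → a ≈[ M ] b → mul1+ c k a ≈[ M ] mul1+ c k b
mul1+-cong[] c k M e = ⊕-cong[] e (·-cong[] c (shift-cong[] k M e))

mul1+-cong : ∀ c k {a b} → a ≈ b → mul1+ c k a ≈ mul1+ c k b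
mul1+-cong c k e = ≈[]⇒≈ (λ M → mul1+-cong[] c k M (≈⇒≈[] M e))

mul1+-≈[] : ∀ c k a M → M < k → mul1+ c k a ≈[ M ] a
mul1+-≈[] c k a M lt n p = begin
  a n +ℤ c *ℤ shift k a n  ≡⟨ cong (λ t → a n +ℤ c *ℤ t) (shift-≈[]𝟘 k a M lt n p) ⟩
  a n +ℤ c *ℤ 0ℤ           ≡⟨ cong (a n +ℤ_) (ℤ.*-zeroʳ c) ⟩
  a n +ℤ 0ℤ                ≡⟨ ℤ.+-identityʳ (a n) ⟩
  a n                      ∎
  where open ≡-Reasoning

-- The coefficient of xⁿ in (1 + c xᵏ⁺¹) a determines a n from the lower coefficients.
mul1+-cancel[] : ∀ c k {a b} M → mul1+ c (suc k) a ≈[ M ] mul1+ c (suc k) b → a ≈[ M ] b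
mul1+-cancel[] c k {a} {b} M e n p = go (suc n) n ℕ.≤-refl p
  where
  subtract : ∀ u v c → u +ℤ c *ℤ v - c *ℤ v ≡ u
  subtract = solve-∀
  go : ∀ B n → n < B → n ≤ M → a n ≡ b n
  go (suc B) n (s≤s q) p = begin
    a n                                                     ≡⟨ subtract (a n) _ c ⟨
    a n +ℤ c *ℤ shift (suc k) a n - c *ℤ shift (suc k) a n  ≡⟨ cong₂ (λ s t → s - c *ℤ t) (e n p) lower ⟩
    b n +ℤ c *ℤ shift (suc k) b n - c *ℤ shift (suc k) b n  ≡⟨ subtract (b n) _ c ⟩
    b n                                                     ∎
    where
    open ≡-Reasoning
    lower : shift (suc k) a n ≡ shift (suc k) b n
    lower = shift-suc-cong< k a b n
      (λ i r → go B i (ℕ.≤-trans r q) (ℕ.≤-trans (ℕ.<⇒≤ r) p))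

mul1+-cancel : ∀ c k {a b} → mul1+ c (suc k) a ≈ mul1+ c (suc k) b → a ≈ b
mul1+-cancel c k e = ≈[]⇒≈ (λ M → mul1+-cancel[] c k M (≈⇒≈[] M e))

mul1+-solve : ∀ c k {a b t u} → a ≈ b ⊕ shift k t → t ≈ c · a ⊕ u → mul1+ (- c) k a ≈ b ⊕ shift k u
mul1+-solve c k {a} {b} {t} {u} a≈ t≈ n = begin
  a n +ℤ (- c) *ℤ shift k a n
    ≡⟨ cong (_+ℤ (- c) *ℤ shift k a n) (a≈ n) ⟩
  b n +ℤ shift k t n +ℤ (- c) *ℤ shift k a n
    ≡⟨ cong (λ z → b n +ℤ z +ℤ (- c) *ℤ shift k a n)
            (trans (shift-cong k t≈ n)
                   (trans (shift-⊕ k (c · a) u n) (cong (_+ℤ shift k u n) (shift-· k c a n)))) ⟩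
  b n +ℤ (c *ℤ shift k a n +ℤ shift k u n) +ℤ (- c) *ℤ shift k a n
    ≡⟨ cancel (b n) (shift k a n) (shift k u n) c ⟩
  b n +ℤ shift k u n ∎
  where
  open ≡-Reasoning
  cancel : ∀ x y z c → x +ℤ (c *ℤ y +ℤ z) +ℤ (- c) *ℤ y ≡ x +ℤ z
  cancel = solve-∀

mul1+-solve₀ : ∀ c k {a b t} → a ≈ b ⊕ shift k t → t ≈ c · a → mul1+ (- c) k a ≈ b
mul1+-solve₀ c k {a} {b} a≈ t≈ n =
  trans (mul1+-solve c k {a} {b} {u = 𝟘} a≈ (λ m → trans (t≈ m) (sym (ℤ.+-identityʳ _))) n)
        (trans (cong (b n +ℤ_) (shift-𝟘 k n)) (ℤ.+-identityʳ (b n)))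

-- Multiplication by a fixed power series, axiomatised by what the proofs use of it.
record IsMultiplier (T : Series → Series) : Set where
  field
    mult-cong[] : ∀ M {a b} → a ≈[ M ] b → T a ≈[ M ] T b
    mult-⊕      : ∀ a b → T (a ⊕ b) ≈ T a ⊕ T b
    mult-·      : ∀ c a → T (c · a) ≈ c · T a
    mult-shift  : ∀ k a → T (shift k a) ≈ shift k (T a)
open IsMultiplier public

mult-cong : ∀ {T} → IsMultiplier T → ∀ {a b} → a ≈ b → T a ≈ T b
mult-cong T e = ≈[]⇒≈ (λ M → mult-cong[] T M (≈⇒≈[] M e))

mult-mul1+ : ∀ {T} → IsMultiplier T → ∀ c k a → T (mul1+ c k a) ≈ mul1+ c k (T a)
mult-mul1+ {T} G c k a n = begin
  T (a ⊕ c · shift k a) n           ≡⟨ mult-⊕ G a (c · shift k a) n ⟩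
  T a n +ℤ T (c · shift k a) n      ≡⟨ cong (T a n +ℤ_) (mult-· G c (shift k a) n) ⟩
  T a n +ℤ c *ℤ T (shift k a) n     ≡⟨ cong (λ t → T a n +ℤ c *ℤ t) (mult-shift G k a n) ⟩
  T a n +ℤ c *ℤ shift k (T a) n     ∎
  where open ≡-Reasoning

id-multiplier : IsMultiplier (λ a → a)
id-multiplier = record
  { mult-cong[] = λ M e → e
  ; mult-⊕      = λ a b n → refl
  ; mult-·      = λ c a n → refl
  ; mult-shift  = λ k a n → refl
  }

∘-multiplier : ∀ {T U} → IsMultiplier T → IsMultiplier U → IsMultiplier (λ a → T (U a))
∘-multiplier {T} {U} G H = record
  { mult-cong[] = λ M e → mult-cong[] G M (mult-cong[] H M e)
  ; mult-⊕      = λ a b → ≈-trans (mult-cong G (mult-⊕ H a b)) (mult-⊕ G (U a) (U b))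
  ; mult-·      = λ c a → ≈-trans (mult-cong G (mult-· H c a)) (mult-· G c (U a))
  ; mult-shift  = λ k a → ≈-trans (mult-cong G (mult-shift H k a)) (mult-shift G k (U a))
  }

⊕-multiplier : ∀ {T U} → IsMultiplier T → IsMultiplier U → IsMultiplier (λ a → T a ⊕ U a)
⊕-multiplier {T} {U} G H = record
  { mult-cong[] = λ M e → ⊕-cong[] (mult-cong[] G M e) (mult-cong[] H M e)
  ; mult-⊕      = λ a b n → trans (cong₂ _+ℤ_ (mult-⊕ G a b n) (mult-⊕ H a b n))
                                  (interchange (T a n) (T b n) (U a n) (U b n))
  ; mult-·      = λ c a n → trans (cong₂ _+ℤ_ (mult-· G c a n) (mult-· H c a n))
                                  (sym (ℤ.*-distribˡ-+ c (T a n) (U a n)))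
  ; mult-shift  = λ k a → ≈-trans (⊕-cong (mult-shift G k a) (mult-shift H k a))
                                  (≈-sym (shift-⊕ k (T a) (U a)))
  }
  where
  interchange : ∀ x y u v → (x +ℤ y) +ℤ (u +ℤ v) ≡ (x +ℤ u) +ℤ (y +ℤ v)
  interchange = solve-∀

·-multiplier : ∀ {T} (c : ℤ) → IsMultiplier T → IsMultiplier (λ a → c · T a)
·-multiplier {T} c G = record
  { mult-cong[] = λ M e → ·-cong[] c (mult-cong[] G M e)
  ; mult-⊕      = λ a b n → trans (cong (c *ℤ_) (mult-⊕ G a b n)) (ℤ.*-distribˡ-+ c (T a n) (T b n))
  ; mult-·      = λ d a n → trans (cong (c *ℤ_) (mult-· G d a n)) (swap c d (T a n))
  ; mult-shift  = λ k a → ≈-trans (·-cong c (mult-shift G k a)) (≈-sym (shift-· k c (T a)))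
  }
  where
  swap : ∀ c d x → c *ℤ (d *ℤ x) ≡ d *ℤ (c *ℤ x)
  swap = solve-∀

shift-multiplier : ∀ j → IsMultiplier (shift j)
shift-multiplier j = record
  { mult-cong[] = λ M e → shift-cong[] j M e
  ; mult-⊕      = shift-⊕ j
  ; mult-·      = shift-· j
  ; mult-shift  = shift-comm j
  }

𝟘-multiplier : IsMultiplier (λ a → 𝟘)
𝟘-multiplier = record
  { mult-cong[] = λ M e n p → refl
  ; mult-⊕      = λ a b n → refl
  ; mult-·      = λ c a n → sym (ℤ.*-zeroʳ c)
  ; mult-shift  = λ k a → ≈-sym (shift-𝟘 k)
  }

mul1+-multiplier : ∀ c k → IsMultiplier (mul1+ c k)
mul1+-multiplier c k = ⊕-multiplier id-multiplier (·-multiplier c (shift-multiplier k))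

mul1+-conjugate : ∀ k a → mul1+ 1ℤ k (mul1+ -1ℤ k a) ≈ mul1+ -1ℤ (k + k) a
mul1+-conjugate k a n = begin
  (a n +ℤ -1ℤ *ℤ shift k a n) +ℤ 1ℤ *ℤ shift k (mul1+ -1ℤ k a) n
    ≡⟨ cong (λ t → (a n +ℤ -1ℤ *ℤ shift k a n) +ℤ 1ℤ *ℤ t)
            (mult-mul1+ (shift-multiplier k) -1ℤ k a n) ⟩
  (a n +ℤ -1ℤ *ℤ shift k a n) +ℤ 1ℤ *ℤ (shift k a n +ℤ -1ℤ *ℤ shift k (shift k a) n)
    ≡⟨ telescope (a n) (shift k a n) _ ⟩
  a n +ℤ -1ℤ *ℤ shift k (shift k a) n
    ≡⟨ cong (λ t → a n +ℤ -1ℤ *ℤ t) (shift-+ k k a n) ⟩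
  a n +ℤ -1ℤ *ℤ shift (k + k) a n ∎
  where
  open ≡-Reasoning
  telescope : ∀ u v w → (u +ℤ -1ℤ *ℤ v) +ℤ 1ℤ *ℤ (v +ℤ -1ℤ *ℤ w) ≡ u +ℤ -1ℤ *ℤ w
  telescope = solve-∀

-- recip c k a = a / (1 - c xᵏ⁺¹); the exponent is suc k so that the geometric series
-- a + c xᵏ⁺¹ a + c² x²ᵏ⁺² a + … converges.  Iterating f times fixes all coefficients ≤ f.
iterateRecip : ℤ → ℕ → Series → ℕ → Series
iterateRecip c k a zero = a
iterateRecip c k a (suc f) = a ⊕ c · shift (suc k) (iterateRecip c k a f)

iterateRecip-suc : ∀ c k a f → iterateRecip c k a f ≈[ f ] iterateRecip c k a (suc f)
iterateRecip-suc c k a zero zero p = sym (mul1+-≈[] c (suc k) a 0 (s≤s z≤n) 0 p)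
iterateRecip-suc c k a (suc f) n p = cong (λ t → a n +ℤ c *ℤ t)
  (shift-suc-cong< k _ _ n (λ i q → iterateRecip-suc c k a f i (ℕ.≤-pred (ℕ.≤-trans q p))))

iterateRecip-mono : ∀ c k a f g → f ≤ g → iterateRecip c k a f ≈[ f ] iterateRecip c k a g
iterateRecip-mono c k a f zero z≤n n p = refl
iterateRecip-mono c k a zero (suc g) z≤n zero p =
  trans (iterateRecip-mono c k a zero g z≤n zero p) (iterateRecip-suc c k a g zero z≤n)
iterateRecip-mono c k a (suc f) (suc g) (s≤s le) n p = cong (λ t → a n +ℤ c *ℤ t)
  (shift-suc-cong< k _ _ n (λ i q → iterateRecip-mono c k a f g le i (ℕ.≤-pred (ℕ.≤-trans q p))))

recip : ℤ → ℕ → Series → Series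
recip c k a n = iterateRecip c k a n n

recip-unfold : ∀ c k a → recip c k a ≈ a ⊕ c · shift (suc k) (recip c k a)
recip-unfold c k a zero = sym (mul1+-≈[] c (suc k) a 0 (s≤s z≤n) 0 z≤n)
recip-unfold c k a (suc n) = cong (λ t → a (suc n) +ℤ c *ℤ t)
  (shift-suc-cong< k _ _ (suc n) (λ i q → sym (iterateRecip-mono c k a i n (ℕ.≤-pred q) i ℕ.≤-refl)))

mul1+-recip : ∀ c k a → mul1+ (- c) (suc k) (recip c k a) ≈ a
mul1+-recip c k a n =
  trans (cong (λ t → t +ℤ (- c) *ℤ shift (suc k) (recip c k a) n) (recip-unfold c k a n))
        (cancel (a n) _ c)
  where
  cancel : ∀ u v c → (u +ℤ c *ℤ v) +ℤ (- c) *ℤ v ≡ u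
  cancel = solve-∀

recip-unique[] : ∀ c k {y a} M → mul1+ (- c) (suc k) y ≈[ M ] a → y ≈[ M ] recip c k a
recip-unique[] c k M e = mul1+-cancel[] (- c) k M (λ n p → trans (e n p) (sym (mul1+-recip c k _ n)))

recip-unique : ∀ c k {y a} → mul1+ (- c) (suc k) y ≈ a → y ≈ recip c k a
recip-unique c k e = ≈[]⇒≈ (λ M → recip-unique[] c k M (≈⇒≈[] M e))

recip-mul1+ : ∀ c k a → recip c k (mul1+ (- c) (suc k) a) ≈ a
recip-mul1+ c k a = ≈-sym (recip-unique c k (λ n → refl))

recip-multiplier : ∀ c k → IsMultiplier (recip c k)
recip-multiplier c k = record
  { mult-cong[] = λ M {a} e → recip-unique[] c k M (λ n p → trans (mul1+-recip c k a n) (e n p))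
  ; mult-⊕      = λ a b → ≈-sym (recip-unique c k (≈-trans (mult-⊕ F (recip c k a) (recip c k b))
                                                  (⊕-cong (mul1+-recip c k a) (mul1+-recip c k b))))
  ; mult-·      = λ d a → ≈-sym (recip-unique c k (≈-trans (mult-· F d (recip c k a))
                                                  (·-cong d (mul1+-recip c k a))))
  ; mult-shift  = λ j a → ≈-sym (recip-unique c k (≈-trans (mult-shift F j (recip c k a))
                                                  (shift-cong j (mul1+-recip c k a))))
  }
  where F = mul1+-multiplier (- c) (suc k)

mul1+-shift-recip : ∀ c k j a → mul1+ (- c) (suc k) (shift j (recip c k a)) ≈ shift j a
mul1+-shift-recip c k j a =
  ≈-trans (≈-sym (mult-mul1+ (shift-multiplier j) (- c) (suc k) (recip c k a))) (shift-cong j (mul1+-recip c k a))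

frac : ℤ → ℕ → Series → Series
frac c k a = shift (suc k) (recip c k a)

frac-multiplier : ∀ c k → IsMultiplier (frac c k)
frac-multiplier c k = ∘-multiplier (shift-multiplier (suc k)) (recip-multiplier c k)

mul1+-frac : ∀ c k a → mul1+ (- c) (suc k) (frac c k a) ≈ shift (suc k) a
mul1+-frac c k = mul1+-shift-recip c k (suc k)

-- geom k a = xᵏ a / (1 - xᵏ), with the junk value 0 for k = 0.
geom : ℕ → Series → Series
geom zero    a = 𝟘
geom (suc k) a = frac 1ℤ k a

-- xᵏ/(1 - xᵏ) - xᵏ/(1 + xᵏ) = 2 x²ᵏ/(1 - x²ᵏ), checked after multiplying by 1 - x²ᵏ.
frac-difference : ∀ j a → frac 1ℤ j a ⊝ frac -1ℤ j a ≈ + 2 · geom (suc j + suc j) a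
frac-difference j a = mul1+-cancel -1ℤ (j + suc j) (begin
  mul1+ -1ℤ (k + k) (A ⊝ B)
    ≈⟨ mult-cong M (λ n → cong (A n +ℤ_) (sym (ℤ.-1*i≡-i (B n)))) ⟩
  mul1+ -1ℤ (k + k) (A ⊕ -1ℤ · B)
    ≈⟨ ≈-trans (mult-⊕ M A (-1ℤ · B)) (⊕-congʳ (mul1+ -1ℤ (k + k) A) (mult-· M -1ℤ B)) ⟩
  mul1+ -1ℤ (k + k) A ⊕ -1ℤ · mul1+ -1ℤ (k + k) B
    ≈⟨ ⊕-cong (≈-trans (≈-sym (mul1+-conjugate k A)) (mul1+-cong 1ℤ k (mul1+-frac 1ℤ j a)))
              (·-cong -1ℤ (≈-trans (≈-sym (≈-trans (mult-mul1+ (mul1+-multiplier -1ℤ k) 1ℤ k B)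
                                                   (mul1+-conjugate k B)))
                                   (mul1+-cong -1ℤ k (mul1+-frac -1ℤ j a)))) ⟩
  mul1+ 1ℤ k (shift k a) ⊕ -1ℤ · mul1+ -1ℤ k (shift k a)
    ≈⟨ (λ n → trans (difference (shift k a n) (shift k (shift k a) n)) (cong (+ 2 *ℤ_) (shift-+ k k a n))) ⟩
  + 2 · shift (k + k) a
    ≈⟨ ·-cong (+ 2) (mul1+-frac 1ℤ (j + suc j) a) ⟨
  + 2 · mul1+ -1ℤ (k + k) (geom (k + k) a)
    ≈⟨ mult-· M (+ 2) (geom (k + k) a) ⟨
  mul1+ -1ℤ (k + k) (+ 2 · geom (k + k) a) ∎)
  where
  open ≈-Reasoning
  k = suc j
  A = frac 1ℤ j a
  B = frac -1ℤ j a
  M = mul1+-multiplier -1ℤ (k + k)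
  difference : ∀ x y → (x +ℤ 1ℤ *ℤ y) +ℤ -1ℤ *ℤ (x +ℤ -1ℤ *ℤ y) ≡ + 2 *ℤ y
  difference = solve-∀

sumUpTo : (ℕ → Series → Series) → ℕ → Series → Series
sumUpTo t zero    a = 𝟘
sumUpTo t (suc K) a = sumUpTo t K a ⊕ t (suc K) a

sumUpTo-multiplier : ∀ t → (∀ k → IsMultiplier (t k)) → ∀ K → IsMultiplier (sumUpTo t K)
sumUpTo-multiplier t mult zero    = 𝟘-multiplier
sumUpTo-multiplier t mult (suc K) = ⊕-multiplier (sumUpTo-multiplier t mult K) (mult (suc K))

sumUpTo-⊝ : ∀ t u v w c → (∀ k a → t (suc k) a ⊝ u (suc k) a ≈ c · v (suc k) a ⊝ w (suc k) a) →
            ∀ K a → sumUpTo t K a ⊝ sumUpTo u K a ≈ c · sumUpTo v K a ⊝ sumUpTo w K a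
sumUpTo-⊝ t u v w c termwise zero    a n = cong (_- 0ℤ) (sym (ℤ.*-zeroʳ c))
sumUpTo-⊝ t u v w c termwise (suc K) a n =
  add (sumUpTo t K a n) _ _ _ (t (suc K) a n) _ _ _ c (sumUpTo-⊝ t u v w c termwise K a n) (termwise K a n)
  where
  add : ∀ T U V W x y z w c → T - U ≡ c *ℤ V - W → x - y ≡ c *ℤ z - w →
        (T +ℤ x) - (U +ℤ y) ≡ c *ℤ (V +ℤ z) - (W +ℤ w)
  add T U V W x y z w c e₁ e₂ = trans (split T U x y) (trans (cong₂ _+ℤ_ e₁ e₂) (merge c V W z w))
    where
    split : ∀ T U x y → (T +ℤ x) - (U +ℤ y) ≡ (T - U) +ℤ (x - y)
    split = solve-∀
    merge : ∀ c V W z w → (c *ℤ V - W) +ℤ (c *ℤ z - w) ≡ c *ℤ (V +ℤ z) - (W +ℤ w)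
    merge = solve-∀

sumUpTo-≈[] : ∀ t M K K′ a → K ≤ K′ → (∀ k → K < k → t k a ≈[ M ] 𝟘) →
              sumUpTo t K′ a ≈[ M ] sumUpTo t K a
sumUpTo-≈[] t M K K′ a K≤K′ small with ℕ.m≤n⇒m<n∨m≡n K≤K′
... | inj₂ refl = λ n p → refl
sumUpTo-≈[] t M K (suc K′) a _ small | inj₁ (s≤s K≤K′) = λ n p → begin
  sumUpTo t K′ a n +ℤ t (suc K′) a n  ≡⟨ cong (sumUpTo t K′ a n +ℤ_) (small (suc K′) (s≤s K≤K′) n p) ⟩
  sumUpTo t K′ a n +ℤ 0ℤ              ≡⟨ ℤ.+-identityʳ _ ⟩
  sumUpTo t K′ a n                    ≡⟨ sumUpTo-≈[] t M K K′ a K≤K′ small n p ⟩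
  sumUpTo t K a n                     ∎
  where open ≡-Reasoning

geom-≈[]-sumUpTo : ∀ j q M → geom (suc j) q ≈[ M ] sumUpTo (λ b → shift (suc j * b)) M q
geom-≈[]-sumUpTo j q M = mul1+-cancel[] -1ℤ j M (λ n p → begin
  mul1+ -1ℤ k (geom k q) n           ≡⟨ mul1+-frac 1ℤ j q n ⟩
  shift k q n                        ≡⟨ ℤ.+-identityʳ _ ⟨
  shift k q n +ℤ 0ℤ
    ≡⟨ cong (λ x → shift k q n +ℤ - x) (shift-≈[]𝟘 (k * suc M) q M (ℕ.m≤n*m (suc M) k) n p) ⟨
  shift k q n - shift (k * suc M) q n ≡⟨ telescope M n ⟨
  mul1+ -1ℤ k (G M) n                ∎)
  where
  open ≡-Reasoning
  k = suc j
  G = λ B → sumUpTo (λ b → shift (k * b)) B q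
  telescope : ∀ B → mul1+ -1ℤ k (G B) ≈ shift k q ⊝ shift (k * suc B) q
  telescope zero n = begin
    0ℤ +ℤ -1ℤ *ℤ shift k 𝟘 n   ≡⟨ cong (λ x → 0ℤ +ℤ -1ℤ *ℤ x) (shift-𝟘 k n) ⟩
    0ℤ                         ≡⟨ ℤ.+-inverseʳ (shift k q n) ⟨
    shift k q n - shift k q n ≡⟨ cong (λ m → shift k q n - shift m q n) (ℕ.*-identityʳ k) ⟨
    shift k q n - shift (k * 1) q n ∎
  telescope (suc B) n = begin
    mul1+ -1ℤ k (G B ⊕ Y) n
      ≡⟨ mult-⊕ (mul1+-multiplier -1ℤ k) (G B) Y n ⟩
    mul1+ -1ℤ k (G B) n +ℤ (Y n +ℤ -1ℤ *ℤ shift k Y n)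
      ≡⟨ cong₂ (λ x z → x +ℤ (Y n +ℤ -1ℤ *ℤ z)) (telescope B n)
               (trans (shift-+ k (k * suc B) q n) (cong (λ m → shift m q n) (sym (ℕ.*-suc k (suc B))))) ⟩
    (shift k q n - Y n) +ℤ (Y n +ℤ -1ℤ *ℤ shift (k * suc (suc B)) q n)
      ≡⟨ collapse (shift k q n) (Y n) _ ⟩
    shift k q n - shift (k * suc (suc B)) q n ∎
    where
    Y = shift (k * suc B) q
    collapse : ∀ x y z → (x - y) +ℤ (y +ℤ -1ℤ *ℤ z) ≡ x - z
    collapse = solve-∀

Factor : Set
Factor = ℤ × ℕ

mulAll : List Factor → Series → Series
mulAll [] a = a
mulAll ((c , k) ∷ fs) a = mulAll fs (mul1+ c k a)

mulAll-multiplier : ∀ fs → IsMultiplier (mulAll fs)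
mulAll-multiplier [] = id-multiplier
mulAll-multiplier ((c , k) ∷ fs) = ∘-multiplier (mulAll-multiplier fs) (mul1+-multiplier c k)

mulAll-mul1+ : ∀ fs c k a → mulAll fs (mul1+ c k a) ≈ mul1+ c k (mulAll fs a)
mulAll-mul1+ fs = mult-mul1+ (mulAll-multiplier fs)

mulAll-comm : ∀ fs gs a → mulAll fs (mulAll gs a) ≈ mulAll gs (mulAll fs a)
mulAll-comm fs [] a n = refl
mulAll-comm fs ((c , k) ∷ gs) a = ≈-trans (mulAll-comm fs gs (mul1+ c k a))
  (mult-cong (mulAll-multiplier gs) (mulAll-mul1+ fs c k a))

PositiveDegree : Factor → Set
PositiveDegree (c , k) = 1 ≤ k

mulAll-cancel[] : ∀ fs M {a b} → All PositiveDegree fs → mulAll fs a ≈[ M ] mulAll fs b → a ≈[ M ] b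
mulAll-cancel[] [] M [] e = e
mulAll-cancel[] ((c , suc k) ∷ fs) M (s≤s z≤n ∷ ps) e = mul1+-cancel[] c k M (mulAll-cancel[] fs M ps e)

mulAll-++ : ∀ fs gs a → mulAll (fs ++ gs) a ≈ mulAll gs (mulAll fs a)
mulAll-++ [] gs a n = refl
mulAll-++ ((c , k) ∷ fs) gs a = mulAll-++ fs gs (mul1+ c k a)

mulAll-≈[] : ∀ fs M a → All (λ φ → M < proj₂ φ) fs → mulAll fs a ≈[ M ] a
mulAll-≈[] [] M a [] n p = refl
mulAll-≈[] ((c , k) ∷ fs) M a (lt ∷ lts) =
  ≈[]-trans (mulAll-≈[] fs M (mul1+ c k a) lts) (mul1+-≈[] c k a M lt)

productUpTo : (ℕ → List Factor) → ℕ → List Factor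
productUpTo f zero = []
productUpTo f (suc K) = f (suc K) ++ productUpTo f K

productUpTo-[] : ∀ K → productUpTo (λ _ → []) K ≡ []
productUpTo-[] zero    = refl
productUpTo-[] (suc K) = productUpTo-[] K

productUpTo-positive : ∀ f → (∀ k → All PositiveDegree (f (suc k))) →
                       ∀ K → All PositiveDegree (productUpTo f K)
productUpTo-positive f pos zero = []
productUpTo-positive f pos (suc K) = Allₚ.++⁺ (pos K) (productUpTo-positive f pos K)

productUpTo-factorwise : ∀ f g h → (∀ k a → mulAll (g k) (mulAll (h k) a) ≈ mulAll (f k) a) →
                         ∀ K a → mulAll (productUpTo g K) (mulAll (productUpTo h K) a) ≈ mulAll (productUpTo f K) a
productUpTo-factorwise f g h gh≈f zero a n = refl
productUpTo-factorwise f g h gh≈f (suc K) a n = begin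
  mulAll (productUpTo g (suc K)) (mulAll (productUpTo h (suc K)) a) n
    ≡⟨ trans (mulAll-++ (g (suc K)) _ _ n)
             (mult-cong (∘-multiplier (mulAll-multiplier (productUpTo g K)) (mulAll-multiplier (g (suc K))))
                        (mulAll-++ (h (suc K)) _ a) n) ⟩
  mulAll (productUpTo g K) (mulAll (g (suc K)) (mulAll (productUpTo h K) (mulAll (h (suc K)) a))) n
    ≡⟨ mult-cong (mulAll-multiplier (productUpTo g K)) (mulAll-comm (g (suc K)) (productUpTo h K) _) n ⟩
  mulAll (productUpTo g K) (mulAll (productUpTo h K) (mulAll (g (suc K)) (mulAll (h (suc K)) a))) n
    ≡⟨ productUpTo-factorwise f g h gh≈f K _ n ⟩
  mulAll (productUpTo f K) (mulAll (g (suc K)) (mulAll (h (suc K)) a)) n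
    ≡⟨ mult-cong (mulAll-multiplier (productUpTo f K)) (gh≈f (suc K) a) n ⟩
  mulAll (productUpTo f K) (mulAll (f (suc K)) a) n
    ≡⟨ mulAll-++ (f (suc K)) _ a n ⟨
  mulAll (productUpTo f (suc K)) a n ∎
  where open ≡-Reasoning

productUpTo-≈[] : ∀ f → (∀ k → All (λ φ → k + k ≤ proj₂ φ) (f k)) →
                  ∀ h K → h ≤ K → ∀ M → M < suc h + suc h →
                  ∀ a → mulAll (productUpTo f K) a ≈[ M ] mulAll (productUpTo f h) a
productUpTo-≈[] f deg h K h≤K M lt a with ℕ.m≤n⇒m<n∨m≡n h≤K
... | inj₂ refl = λ n p → refl
productUpTo-≈[] f deg h (suc K) h≤K M lt a | inj₁ (s≤s h≤K') = λ n p → begin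
  mulAll (productUpTo f (suc K)) a n
    ≡⟨ mulAll-++ (f (suc K)) _ a n ⟩
  mulAll (productUpTo f K) (mulAll (f (suc K)) a) n
    ≡⟨ mult-cong[] (mulAll-multiplier (productUpTo f K)) M (mulAll-≈[] (f (suc K)) M a
         (All.map (λ le → ℕ.<-≤-trans lt (ℕ.≤-trans (ℕ.+-mono-≤ (s≤s h≤K') (s≤s h≤K')) le))
                  (deg (suc K)))) n p ⟩
  mulAll (productUpTo f K) a n
    ≡⟨ productUpTo-≈[] f deg h K h≤K' M lt a n p ⟩
  mulAll (productUpTo f h) a n ∎
  where open ≡-Reasoning

-- Finite sums and enumerations

guard : {A : Set} {P : Set} → Dec P → List A → List A
guard (yes _) xs = xs
guard (no _)  xs = []

guard-unique : {A P : Set} (d : Dec P) {xs : List A} → Unique xs → Unique (guard d xs)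
guard-unique (yes _) u = u
guard-unique (no _)  u = []

∑ : {A : Set} → (A → ℤ) → List A → ℤ
∑ w []       = 0ℤ
∑ w (x ∷ xs) = w x +ℤ ∑ w xs

∑-++ : {A : Set} (w : A → ℤ) (xs ys : List A) → ∑ w (xs ++ ys) ≡ ∑ w xs +ℤ ∑ w ys
∑-++ w []       ys = sym (ℤ.+-identityˡ _)
∑-++ w (x ∷ xs) ys = trans (cong (w x +ℤ_) (∑-++ w xs ys)) (sym (ℤ.+-assoc (w x) _ _))

∑-map : {A B : Set} (w : B → ℤ) (g : A → B) (xs : List A) → ∑ w (map g xs) ≡ ∑ (λ x → w (g x)) xs
∑-map w g []       = refl
∑-map w g (x ∷ xs) = cong (w (g x) +ℤ_) (∑-map w g xs)

∑-cong : {A : Set} {w w' : A → ℤ} (xs : List A) → (∀ {x} → x ∈ xs → w x ≡ w' x) → ∑ w xs ≡ ∑ w' xs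
∑-cong []       eq = refl
∑-cong (x ∷ xs) eq = cong₂ _+ℤ_ (eq (here refl)) (∑-cong xs (λ m → eq (there m)))

∑-zero : {A : Set} (w : A → ℤ) (xs : List A) → (∀ x → w x ≡ 0ℤ) → ∑ w xs ≡ 0ℤ
∑-zero w []       eq = refl
∑-zero w (x ∷ xs) eq = cong₂ _+ℤ_ (eq x) (∑-zero w xs eq)

∑-* : {A : Set} (c : ℤ) (w : A → ℤ) (xs : List A) → ∑ (λ x → c *ℤ w x) xs ≡ c *ℤ ∑ w xs
∑-* c w []       = sym (ℤ.*-zeroʳ c)
∑-* c w (x ∷ xs) = trans (cong (c *ℤ w x +ℤ_) (∑-* c w xs)) (sym (ℤ.*-distribˡ-+ c (w x) _))

∑-+ : {A : Set} (f g : A → ℤ) (xs : List A) → ∑ (λ x → f x +ℤ g x) xs ≡ ∑ f xs +ℤ ∑ g xs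
∑-+ f g []       = refl
∑-+ f g (x ∷ xs) = trans (cong (f x +ℤ g x +ℤ_) (∑-+ f g xs)) (interchange (f x) (g x) (∑ f xs) (∑ g xs))
  where
  interchange : ∀ a b c d → a +ℤ b +ℤ (c +ℤ d) ≡ a +ℤ c +ℤ (b +ℤ d)
  interchange = solve-∀

∑-difference : {A : Set} (f g : A → ℤ) (xs : List A) → ∑ (λ x → f x - g x) xs ≡ ∑ f xs - ∑ g xs
∑-difference f g []       = refl
∑-difference f g (x ∷ xs) =
  trans (cong (f x - g x +ℤ_) (∑-difference f g xs)) (interchange (f x) (g x) (∑ f xs) (∑ g xs))
  where
  interchange : ∀ a b c d → (a - b) +ℤ (c - d) ≡ (a +ℤ c) - (b +ℤ d)
  interchange = solve-∀

indicator : {P : Set} → Dec P → ℤ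
indicator (yes _) = 1ℤ
indicator (no _)  = 0ℤ

indicator-⇔ : {P Q : Set} → P ⇔ Q → (d : Dec P) (e : Dec Q) → indicator d ≡ indicator e
indicator-⇔ P⇔Q (yes p) (yes q) = refl
indicator-⇔ P⇔Q (yes p) (no ¬q) = ⊥-elim (¬q (Equivalence.to P⇔Q p))
indicator-⇔ P⇔Q (no ¬p) (yes q) = ⊥-elim (¬p (Equivalence.from P⇔Q q))
indicator-⇔ P⇔Q (no ¬p) (no ¬q) = refl

indicator-no : {P : Set} → ¬ P → (d : Dec P) → indicator d ≡ 0ℤ
indicator-no ¬p (yes p) = ⊥-elim (¬p p)
indicator-no ¬p (no _)  = refl

len : List ℕ → ℤ
len μ = + length μ

∑-indicator : {A : Set} {P : A → Set} (P? : ∀ x → Dec (P x)) (f : A → ℤ) (xs : List A) →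
              ∑ f (filter P? xs) ≡ ∑ (λ x → indicator (P? x) *ℤ f x) xs
∑-indicator P? f [] = refl
∑-indicator P? f (x ∷ xs) with P? x
... | yes _ = cong₂ _+ℤ_ (sym (ℤ.*-identityˡ (f x))) (∑-indicator P? f xs)
... | no _  = trans (∑-indicator P? f xs) (sym (ℤ.+-identityˡ _))

+sum-map : {A : Set} (f : A → ℕ) (xs : List A) → + sum (map f xs) ≡ ∑ (λ x → + f x) xs
+sum-map f []       = refl
+sum-map f (x ∷ xs) = trans (ℤ.pos-+ (f x) _) (cong (+ f x +ℤ_) (+sum-map f xs))

+length : {A : Set} (xs : List A) → + length xs ≡ ∑ (λ _ → 1ℤ) xs
+length []       = refl
+length (x ∷ xs) = trans (ℤ.pos-+ 1 (length xs)) (cong (1ℤ +ℤ_) (+length xs))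

+length-concatMap : {A B : Set} (f : A → List B) (xs : List A) →
                    + length (concatMap f xs) ≡ ∑ (λ x → + length (f x)) xs
+length-concatMap f []       = refl
+length-concatMap f (x ∷ xs) =
  trans (cong +_ (List.length-++ (f x)))
        (trans (ℤ.pos-+ (length (f x)) _) (cong (+ length (f x) +ℤ_) (+length-concatMap f xs)))

Enumerates-↭ : {A : Set} {L L′ : List A} {P : A → Set} → Enumerates L P → Enumerates L′ P → L ↭ L′
Enumerates-↭ (uL , L⇔P) (uL′ , L′⇔P) = ∼bag⇒↭ (unique∧set⇒bag uL uL′ (λ {x} →
  mk⇔ (λ m → proj₂ (L′⇔P x) (proj₁ (L⇔P x) m)) (λ m → proj₂ (L⇔P x) (proj₁ (L′⇔P x) m))))

concatMap-unique : {A B : Set} (f : A → List B) (tag : B → A) {xs : List A} → Unique xs →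
  (∀ x → Unique (f x)) → (∀ {x y} → y ∈ f x → tag y ≡ x) → Unique (concatMap f xs)
concatMap-unique f tag []         uf tagged = []
concatMap-unique f tag {x ∷ xs} (x∉xs ∷ u) uf tagged =
  Uniqueₚ.++⁺ (uf x) (concatMap-unique f tag u uf tagged) disjoint
  where
  disjoint : ∀ {v} → ¬ (v ∈ f x × v ∈ concatMap f xs)
  disjoint (m₁ , m₂) with find (∈-concatMap⁻ f {xs = xs} m₂)
  ... | x′ , x′∈xs , m₃ = All.lookup x∉xs x′∈xs (trans (sym (tagged m₁)) (tagged m₃))

oneTo : ℕ → List ℕ
oneTo = applyDownFrom suc

∈-oneTo⁻ : ∀ {n k} → k ∈ oneTo n → 1 ≤ k × k ≤ n
∈-oneTo⁻ m with ∈-applyDownFrom⁻ suc m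
... | i , i<n , refl = s≤s z≤n , i<n

∈-oneTo⁺ : ∀ {n k} → 1 ≤ k → k ≤ n → k ∈ oneTo n
∈-oneTo⁺ {k = suc i} _ k≤n = ∈-applyDownFrom⁺ suc k≤n

oneTo-unique : ∀ n → Unique (oneTo n)
oneTo-unique n = Uniqueₚ.applyDownFrom⁺₁ suc n (λ j<i _ eq → ℕ.<⇒≢ j<i (sym (ℕ.suc-injective eq)))

sumUpTo-∑ : ∀ t K a n → sumUpTo t K a n ≡ ∑ (λ k → t k a n) (oneTo K)
sumUpTo-∑ t zero    a n = refl
sumUpTo-∑ t (suc K) a n = trans (ℤ.+-comm (sumUpTo t K a n) _) (cong (t (suc K) a n +ℤ_) (sumUpTo-∑ t K a n))

+length-guard : {A P : Set} (d : Dec P) (xs : List A) → + length (guard d xs) ≡ indicator d *ℤ + length xs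
+length-guard (yes _) xs = sym (ℤ.*-identityˡ _)
+length-guard (no _)  xs = refl

indicator-shift : ∀ k (q : Series) n → indicator (k ≤? n) *ℤ q (n ∸ k) ≡ shift k q n
indicator-shift k q n with k ≤? n
... | yes k≤n = trans (ℤ.*-identityˡ (q (n ∸ k))) (sym (shift-≤ k q n k≤n))
... | no  k≰n = trans (ℤ.*-zeroˡ (q (n ∸ k))) (sym (shift-< k q n (ℕ.≰⇒> k≰n)))

-- Partitions

noParts : ℕ → List (List ℕ)
noParts zero    = [] ∷ []
noParts (suc n) = []

-- The partitions of n with parts ≤ K, by cases on whether K is a part.  The fuel f ≥ n
-- only makes the recursion structural.
partitionsWith : ℕ → ℕ → ℕ → List (List ℕ)
partitionsWith f       zero    n = noParts n
partitionsWith zero    (suc K) n = noParts n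
partitionsWith (suc f) (suc K) n =
  partitionsWith (suc f) K n ++ guard (suc K ≤? n) (map (suc K ∷_) (partitionsWith f (suc K) (n ∸ suc K)))

partitions : ℕ → ℕ → List (List ℕ)
partitions K n = partitionsWith n K n

partitionsWith-0 : ∀ f K → partitionsWith f K 0 ≡ [] ∷ []
partitionsWith-0 f       zero    = refl
partitionsWith-0 zero    (suc K) = refl
partitionsWith-0 (suc f) (suc K) = trans (List.++-identityʳ _) (partitionsWith-0 (suc f) K)

∸-suc-≤ : ∀ {f n} K → n ≤ suc f → n ∸ suc K ≤ f
∸-suc-≤ {f} {n} K le = ℕ.≤-trans (ℕ.∸-monoʳ-≤ n (s≤s (z≤n {K}))) (ℕ.∸-monoˡ-≤ 1 le)

partitionsWith-suc : ∀ f K n → n ≤ f → partitionsWith f K n ≡ partitionsWith (suc f) K n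
partitionsWith-suc f       zero    n le = refl
partitionsWith-suc zero    (suc K) n z≤n = sym (partitionsWith-0 1 (suc K))
partitionsWith-suc (suc f) (suc K) n le =
  cong₂ _++_ (partitionsWith-suc (suc f) K n le) (guarded (suc K ≤? n))
  where
  guarded : (d : Dec (suc K ≤ n)) →
            guard d (map (suc K ∷_) (partitionsWith f (suc K) (n ∸ suc K))) ≡
            guard d (map (suc K ∷_) (partitionsWith (suc f) (suc K) (n ∸ suc K)))
  guarded (yes _) = cong (map (suc K ∷_)) (partitionsWith-suc f (suc K) (n ∸ suc K) (∸-suc-≤ K le))
  guarded (no _)  = refl

partitionsWith-mono : ∀ f g K n → n ≤ f → f ≤ g → partitionsWith f K n ≡ partitionsWith g K n
partitionsWith-mono f g K n n≤f f≤g with ℕ.m≤n⇒m<n∨m≡n f≤g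
... | inj₂ refl = refl
partitionsWith-mono f (suc g) K n n≤f _ | inj₁ (s≤s f≤g) =
  trans (partitionsWith-mono f g K n n≤f f≤g) (partitionsWith-suc g K n (ℕ.≤-trans n≤f f≤g))

partitionsWith-fuel : ∀ f g K n → n ≤ f → n ≤ g → partitionsWith f K n ≡ partitionsWith g K n
partitionsWith-fuel f g K n n≤f n≤g with ℕ.≤-total f g
... | inj₁ f≤g = partitionsWith-mono f g K n n≤f f≤g
... | inj₂ g≤f = sym (partitionsWith-mono g f K n n≤g g≤f)

Linked⇒All≤head : ∀ {y ys} → Linked _≥_ (y ∷ ys) → All (_≤ y) ys
Linked⇒All≤head [-] = []
Linked⇒All≤head (y≥z ∷ l) = y≥z ∷ All.map (λ q → ℕ.≤-trans q y≥z) (Linked⇒All≤head l)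

Linked-∷ : ∀ {k y} → All (_≤ k) y → Linked _≥_ y → Linked _≥_ (k ∷ y)
Linked-∷ []      []  = [-]
Linked-∷ (p ∷ _) l   = p ∷ l

∈-partitionsWith⁻ : ∀ f K n {x} → x ∈ partitionsWith f K n → IsPartition n x × All (_≤ K) x
∈-partitionsWith⁻ f       zero    zero (here refl) = ([] , [] , refl) , []
∈-partitionsWith⁻ zero    (suc K) zero (here refl) = ([] , [] , refl) , []
∈-partitionsWith⁻ (suc f) (suc K) n {x} mem with ∈-++⁻ (partitionsWith (suc f) K n) mem
... | inj₁ m = let (p , bound) = ∈-partitionsWith⁻ (suc f) K n m in p , All.map ℕ.m≤n⇒m≤1+n bound
... | inj₂ m = guarded (suc K ≤? n) m
  where
  guarded : (d : Dec (suc K ≤ n)) → x ∈ guard d (map (suc K ∷_) (partitionsWith f (suc K) (n ∸ suc K))) →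
            IsPartition n x × All (_≤ suc K) x
  guarded (yes K<n) m with ∈-map⁻ (suc K ∷_) m
  ... | y , my , refl with ∈-partitionsWith⁻ f (suc K) (n ∸ suc K) my
  ... | (lk , pos , s) , bound =
    (Linked-∷ bound lk , s≤s z≤n ∷ pos , trans (cong (λ t → suc K + t) s) (ℕ.m+[n∸m]≡n K<n)) ,
    ℕ.≤-refl ∷ bound

∈-partitionsWith⁺ : ∀ f K n {x} → IsPartition n x → All (_≤ K) x → n ≤ f → x ∈ partitionsWith f K n
∈-partitionsWith⁺ f K n {[]} (lk , pos , refl) bound le = subst ([] ∈_) (sym (partitionsWith-0 f K)) (here refl)
∈-partitionsWith⁺ f zero n {y ∷ ys} (lk , 1≤y ∷ pos , s) (y≤0 ∷ bound) le =
  ⊥-elim (ℕ.<⇒≱ 1≤y y≤0)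
∈-partitionsWith⁺ zero (suc K) n {y ∷ ys} (lk , 1≤y ∷ pos , s) bound z≤n =
  ⊥-elim (ℕ.<⇒≢ 1≤y (sym (ℕ.m+n≡0⇒m≡0 y s)))
∈-partitionsWith⁺ (suc f) (suc K) n {y ∷ ys} (lk , 1≤y ∷ pos , s) (y≤K+1 ∷ bound) le
  with ℕ.m≤n⇒m<n∨m≡n y≤K+1
... | inj₁ (s≤s y≤K) = ∈-++⁺ˡ (∈-partitionsWith⁺ (suc f) K n (lk , 1≤y ∷ pos , s)
                                  (y≤K ∷ All.map (λ t → ℕ.≤-trans t y≤K) (Linked⇒All≤head lk)) le)
... | inj₂ refl = ∈-++⁺ʳ (partitionsWith (suc f) K n) (guarded (suc K ≤? n))
  where
  guarded : (d : Dec (suc K ≤ n)) →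
            (suc K ∷ ys) ∈ guard d (map (suc K ∷_) (partitionsWith f (suc K) (n ∸ suc K)))
  guarded (yes _) = ∈-map⁺ (suc K ∷_) (∈-partitionsWith⁺ f (suc K) (n ∸ suc K)
    (Linked.tail lk , pos , trans (sym (ℕ.m+n∸m≡n (suc K) (sum ys))) (cong (_∸ suc K) s)) bound (∸-suc-≤ K le))
  guarded (no K≮n) = ⊥-elim (K≮n (subst (suc K ≤_) s (ℕ.m≤m+n (suc K) (sum ys))))

partitionsWith-unique : ∀ f K n → Unique (partitionsWith f K n)
partitionsWith-unique f       zero    zero    = [] ∷ []
partitionsWith-unique f       zero    (suc n) = []
partitionsWith-unique zero    (suc K) zero    = [] ∷ []
partitionsWith-unique zero    (suc K) (suc n) = []
partitionsWith-unique (suc f) (suc K) n =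
  Uniqueₚ.++⁺ (partitionsWith-unique (suc f) K n) (guarded (suc K ≤? n)) disjoint
  where
  guarded : (d : Dec (suc K ≤ n)) → Unique (guard d (map (suc K ∷_) (partitionsWith f (suc K) (n ∸ suc K))))
  guarded (yes _) = Uniqueₚ.map⁺ List.∷-injectiveʳ (partitionsWith-unique f (suc K) (n ∸ suc K))
  guarded (no _)  = []
  disjoint : ∀ {v} → ¬ (v ∈ partitionsWith (suc f) K n ×
                        v ∈ guard (suc K ≤? n) (map (suc K ∷_) (partitionsWith f (suc K) (n ∸ suc K))))
  disjoint {v} (m₁ , m₂) = no-K (suc K ≤? n) m₂
    where
    no-K : (d : Dec (suc K ≤ n)) → v ∉ guard d (map (suc K ∷_) (partitionsWith f (suc K) (n ∸ suc K)))
    no-K (yes _) m with ∈-map⁻ (suc K ∷_) m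
    ... | y , _ , refl with proj₂ (∈-partitionsWith⁻ (suc f) K n m₁)
    ...   | K+1≤K ∷ _ = ℕ.<-irrefl refl K+1≤K

genFun : (List ℕ → ℤ) → ℕ → Series
genFun w K n = ∑ w (partitions K n)

genFun-suc : ∀ w K → genFun w (suc K) ≈ genFun w K ⊕ shift (suc K) (genFun (λ μ → w (suc K ∷ μ)) (suc K))
genFun-suc w K zero =
  trans (cong (∑ w) (trans (partitionsWith-0 0 (suc K)) (sym (partitionsWith-0 0 K)))) (sym (ℤ.+-identityʳ _))
genFun-suc w K (suc n) =
  trans (∑-++ w (partitionsWith (suc n) K (suc n)) _) (cong (genFun w K (suc n) +ℤ_) (guarded (suc K ≤? suc n)))
  where
  guarded : (d : Dec (suc K ≤ suc n)) →
            ∑ w (guard d (map (suc K ∷_) (partitionsWith n (suc K) (suc n ∸ suc K)))) ≡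
            shift (suc K) (genFun (λ μ → w (suc K ∷ μ)) (suc K)) (suc n)
  guarded (yes K<n) = begin
    ∑ w (map (suc K ∷_) (partitionsWith n (suc K) (n ∸ K)))
      ≡⟨ ∑-map w (suc K ∷_) (partitionsWith n (suc K) (n ∸ K)) ⟩
    ∑ (λ μ → w (suc K ∷ μ)) (partitionsWith n (suc K) (n ∸ K))
      ≡⟨ cong (∑ (λ μ → w (suc K ∷ μ)))
              (partitionsWith-fuel n (n ∸ K) (suc K) (n ∸ K) (ℕ.m∸n≤m n K) ℕ.≤-refl) ⟩
    genFun (λ μ → w (suc K ∷ μ)) (suc K) (n ∸ K)
      ≡⟨ shift-≤ (suc K) _ (suc n) K<n ⟨
    shift (suc K) (genFun (λ μ → w (suc K ∷ μ)) (suc K)) (suc n) ∎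
    where open ≡-Reasoning
  guarded (no K≮n) = sym (shift-< (suc K) _ (suc n) (ℕ.≰⇒> K≮n))

genFun-*1 : ∀ w K → genFun (λ μ → w μ *ℤ 1ℤ) K ≈ genFun w K
genFun-*1 w K n = ∑-cong (partitions K n) (λ {μ} _ → ℤ.*-identityʳ (w μ))

All-≤-sum : ∀ x → All (_≤ sum x) x
All-≤-sum []       = []
All-≤-sum (y ∷ ys) =
  ℕ.m≤m+n y (sum ys) ∷ All.map (λ p → ℕ.≤-trans p (ℕ.m≤n+m (sum ys) y)) (All-≤-sum ys)

∈-partitions : ∀ {m x} n → IsPartition m x → m ≤ n → x ∈ partitions n m
∈-partitions {m} {x} n p@(_ , _ , refl) m≤n =
  ∈-partitionsWith⁺ m n m p (All.map (λ q → ℕ.≤-trans q m≤n) (All-≤-sum x)) ℕ.≤-refl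

filter-partitions-enumerates : ∀ n {R : List ℕ → Set} (R? : ∀ x → Dec (R x)) →
  Enumerates (filter R? (partitions n n)) (λ x → IsPartition n x × R x)
filter-partitions-enumerates n R? = Uniqueₚ.filter⁺ R? (partitionsWith-unique n n n) , λ x →
  (λ m → let (m′ , Rx) = ∈-filter⁻ R? m in proj₁ (∈-partitionsWith⁻ n n n m′) , Rx) ,
  (λ (p , Rx) → ∈-filter⁺ R? (∈-partitions n p ℕ.≤-refl) Rx)

sumℓ-enumerates : ∀ n {R : List ℕ → Set} (R? : ∀ x → Dec (R x)) {L} →
  Enumerates L (λ x → IsPartition n x × R x) →
  + sumℓ L ≡ ∑ (λ x → indicator (R? x) *ℤ len x) (partitions n n)
sumℓ-enumerates n R? {L} enum = begin
  + sum (map ℓ L)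
    ≡⟨ cong +_ (sum-↭ (↭.map⁺ ℓ (Enumerates-↭ enum (filter-partitions-enumerates n R?)))) ⟩
  + sum (map ℓ (filter R? (partitions n n)))
    ≡⟨ +sum-map ℓ (filter R? (partitions n n)) ⟩
  ∑ len (filter R? (partitions n n))
    ≡⟨ ∑-indicator R? len (partitions n n) ⟩
  ∑ (λ x → indicator (R? x) *ℤ len x) (partitions n n) ∎
  where open ≡-Reasoning

data Parity : ℕ → Set where
  even : ∀ h → Parity (h + h)
  odd  : ∀ h → Parity (suc (h + h))

parity : ∀ K → Parity K
parity zero = even 0
parity (suc K) with parity K
... | even h = odd h
... | odd h  = subst Parity (cong suc (ℕ.+-suc h h)) (even (suc h))

2∤odd : ∀ h → ¬ 2 ∣ suc (h + h)
2∤odd zero d with ∣⇒≤ d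
... | s≤s ()
2∤odd (suc h) d rewrite ℕ.+-suc h h = 2∤odd h (∣m+n∣m⇒∣n d (n∣n {2}))

double : ∀ k → 2 * k ≡ k + k
double k = cong (λ t → k + t) (ℕ.+-identityʳ k)

-1^-parity : ∀ c → (c % 2 ≡ 0 × -1ℤ ^ c ≡ 1ℤ) ⊎ (c % 2 ≡ 1 × -1ℤ ^ c ≡ -1ℤ)
-1^-parity zero          = inj₁ (refl , refl)
-1^-parity (suc zero)    = inj₂ (refl , refl)
-1^-parity (suc (suc c)) with -1^-parity c
... | inj₁ (c%2 , e) = inj₁ (c%2 , cong (λ x → -1ℤ *ℤ (-1ℤ *ℤ x)) e)
... | inj₂ (c%2 , e) = inj₂ (c%2 , cong (λ x → -1ℤ *ℤ (-1ℤ *ℤ x)) e)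

module Modulus (r : ℕ) where

  data Kind : Set where
    plain oddMult evenMult : Kind

  kind : ℕ → Kind
  kind k with 2 * r ∣? k | r ∣? k
  ... | yes _ | _     = evenMult
  ... | no _  | yes _ = oddMult
  ... | no _  | no _  = plain

  2r∣⇒r∣ : ∀ {k} → 2 * r ∣ k → r ∣ k
  2r∣⇒r∣ = m*n∣⇒n∣ 2 r

  2r∤odd : ∀ h → ¬ 2 * r ∣ suc (h + h)
  2r∤odd h d = 2∤odd h (m*n∣⇒m∣ 2 r d)

  r∣⇒2r∣double : ∀ {k} → r ∣ k → 2 * r ∣ k + k
  r∣⇒2r∣double {k} d = subst (2 * r ∣_) (double k) (*-monoʳ-∣ 2 d)

  2r∣double⇒r∣ : ∀ {k} → 2 * r ∣ k + k → r ∣ k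
  2r∣double⇒r∣ {k} d = *-cancelˡ-∣ 2 (subst (2 * r ∣_) (sym (double k)) d)

  kind-evenMult : ∀ {k} → 2 * r ∣ k → kind k ≡ evenMult
  kind-evenMult {k} d with 2 * r ∣? k
  ... | yes _ = refl
  ... | no ¬d = ⊥-elim (¬d d)

  evenMult⇒2r∣ : ∀ {k} → kind k ≡ evenMult → 2 * r ∣ k
  evenMult⇒2r∣ {k} eq with 2 * r ∣? k | r ∣? k
  ... | yes e | _ = e
  evenMult⇒2r∣ () | no _ | yes _
  evenMult⇒2r∣ () | no _ | no _

  oddMult⇒2r∤ : ∀ {k} → kind k ≡ oddMult → ¬ 2 * r ∣ k
  oddMult⇒2r∤ {k} eq with 2 * r ∣? k | r ∣? k
  oddMult⇒2r∤ () | yes _ | _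
  ... | no ¬e | yes _ = ¬e
  oddMult⇒2r∤ () | no _ | no _

  oddMult⇒r∣ : ∀ {k} → kind k ≡ oddMult → r ∣ k
  oddMult⇒r∣ {k} eq with 2 * r ∣? k | r ∣? k
  oddMult⇒r∣ () | yes _ | _
  ... | no _ | yes d = d
  oddMult⇒r∣ () | no _ | no _

  plain⇒r∤ : ∀ {k} → kind k ≡ plain → ¬ r ∣ k
  plain⇒r∤ {k} eq with 2 * r ∣? k | r ∣? k
  plain⇒r∤ () | yes _ | _
  plain⇒r∤ () | no _ | yes _
  ... | no _ | no ¬d = ¬d

  kind-odd : ∀ h → kind (suc (h + h)) ≢ evenMult
  kind-odd h eq = 2r∤odd h (evenMult⇒2r∣ eq)

  kind-double-oddMult : ∀ {k} → kind k ≡ oddMult → kind (k + k) ≡ evenMult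
  kind-double-oddMult eq = kind-evenMult (r∣⇒2r∣double (oddMult⇒r∣ eq))

  kind-double-evenMult : ∀ {k} → kind k ≡ evenMult → kind (k + k) ≡ evenMult
  kind-double-evenMult eq = kind-evenMult (r∣⇒2r∣double (2r∣⇒r∣ (evenMult⇒2r∣ eq)))

  kind-double-plain : ∀ {k} → kind k ≡ plain → kind (k + k) ≢ evenMult
  kind-double-plain eq eq₂ = plain⇒r∤ eq (2r∣double⇒r∣ (evenMult⇒2r∣ eq₂))

  sign : Kind → ℤ
  sign evenMult = -1ℤ
  sign _        = 1ℤ

  -- Euler's identity

  factorsUpTo : (Kind → ℕ → List Factor) → ℕ → List Factor
  factorsUpTo f = productUpTo (λ k → f (kind k) k)

  oddSquare evenPlus evenMinus evenSquare squares euler : Kind → ℕ → List Factor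
  oddSquare oddMult k = (-1ℤ , k + k) ∷ []
  oddSquare _       k = []
  evenPlus evenMult k = (1ℤ , k) ∷ []
  evenPlus _        k = []
  evenMinus evenMult k = (-1ℤ , k) ∷ []
  evenMinus _        k = []
  evenSquare evenMult k = (-1ℤ , k + k) ∷ []
  evenSquare _        k = []
  squares c k = evenSquare c k ++ oddSquare c k
  euler c k = oddSquare c k ++ evenPlus c k

  factorsUpTo-evenMinus-double : ∀ h → factorsUpTo evenMinus (h + h) ≡ factorsUpTo squares h
  factorsUpTo-evenMinus-odd : ∀ h → factorsUpTo evenMinus (suc (h + h)) ≡ factorsUpTo squares h

  factorsUpTo-evenMinus-double zero = refl
  factorsUpTo-evenMinus-double (suc h) = cong₂ _++_ (evenMinus-double (suc h)) (begin
    factorsUpTo evenMinus (h + suc h)      ≡⟨ cong (factorsUpTo evenMinus) (ℕ.+-suc h h) ⟩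
    factorsUpTo evenMinus (suc (h + h))    ≡⟨ factorsUpTo-evenMinus-odd h ⟩
    factorsUpTo squares h                  ∎)
    where
    open ≡-Reasoning
    evenMinus-double : ∀ k → evenMinus (kind (k + k)) (k + k) ≡ squares (kind k) k
    evenMinus-double k with kind k in eq
    ... | oddMult  rewrite kind-double-oddMult eq = refl
    ... | evenMult rewrite kind-double-evenMult eq = refl
    ... | plain with kind (k + k) in eq₂
    ...   | plain    = refl
    ...   | oddMult  = refl
    ...   | evenMult = ⊥-elim (kind-double-plain eq eq₂)

  factorsUpTo-evenMinus-odd h with kind (suc (h + h)) in eq
  ... | plain    = factorsUpTo-evenMinus-double h
  ... | oddMult  = factorsUpTo-evenMinus-double h
  ... | evenMult = ⊥-elim (kind-odd h eq)

  factorsUpTo-factorwise : ∀ f g h → (∀ c k a → mulAll (g c k) (mulAll (h c k) a) ≈ mulAll (f c k) a) →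
                           ∀ K a → mulAll (factorsUpTo g K) (mulAll (factorsUpTo h K) a) ≈ mulAll (factorsUpTo f K) a
  factorsUpTo-factorwise f g h gh≈f = productUpTo-factorwise _ _ _ (λ k → gh≈f (kind k) k)

  evenPlus-evenMinus : ∀ c k a → mulAll (evenPlus c k) (mulAll (evenMinus c k) a) ≈ mulAll (evenSquare c k) a
  evenPlus-evenMinus plain    k a n = refl
  evenPlus-evenMinus oddMult  k a n = refl
  evenPlus-evenMinus evenMult k a   = mul1+-conjugate k a

  oddSquare-degree : ∀ c k → All (λ φ → k + k ≤ proj₂ φ) (oddSquare c k)
  oddSquare-degree plain    k = []
  oddSquare-degree oddMult  k = ℕ.≤-refl ∷ []
  oddSquare-degree evenMult k = []

  evenSquare-degree : ∀ c k → All (λ φ → k + k ≤ proj₂ φ) (evenSquare c k)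
  evenSquare-degree plain    k = []
  evenSquare-degree oddMult  k = []
  evenSquare-degree evenMult k = ℕ.≤-refl ∷ []

  evenSquare-positive : ∀ c k → All PositiveDegree (evenSquare c (suc k))
  evenSquare-positive plain    k = []
  evenSquare-positive oddMult  k = []
  evenSquare-positive evenMult k = s≤s z≤n ∷ []

  -- Modulo x^(K+1) the factors 1 - x²ᵏ with k > h are 1.  So C = ∏_{2r∣k≤h} (1 - x²ᵏ) times
  -- the Euler product is ∏_{2r∣k≤K} (1 + xᵏ) ∏_{r∣k≤h} (1 - x²ᵏ) = ∏_{2r∣k≤K} (1 + xᵏ)(1 - xᵏ),
  -- which is again C; cancel C.
  euler-halving : ∀ h K → h ≤ K → K < suc h + suc h →
                  factorsUpTo evenMinus K ≡ factorsUpTo squares h →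
                  ∀ a → mulAll (factorsUpTo euler K) a ≈[ K ] a
  euler-halving h K h≤K K<2h+2 halve a =
    mulAll-cancel[] C K (productUpTo-positive _ (λ k → evenSquare-positive (kind (suc k)) k) h) chain
    where
    C  = factorsUpTo evenSquare h
    Oₕ = factorsUpTo oddSquare h
    O  = factorsUpTo oddSquare K
    P  = factorsUpTo evenPlus K
    chain : mulAll C (mulAll (factorsUpTo euler K) a) ≈[ K ] mulAll C a
    chain = begin
      mulAll C (mulAll (factorsUpTo euler K) a)
        ≈⟨ ≈⇒≈[] K (mult-cong (mulAll-multiplier C) (factorsUpTo-factorwise euler evenPlus oddSquare
                                                       (λ c k a → ≈-sym (mulAll-++ (oddSquare c k) _ a)) K a)) ⟨
      mulAll C (mulAll P (mulAll O a))
        ≈⟨ mult-cong[] (∘-multiplier (mulAll-multiplier C) (mulAll-multiplier P)) K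
             (productUpTo-≈[] _ (λ k → oddSquare-degree (kind k) k) h K h≤K K K<2h+2 a) ⟩
      mulAll C (mulAll P (mulAll Oₕ a))
        ≈⟨ ≈⇒≈[] K (≈-trans (mulAll-comm C P _) (mult-cong (mulAll-multiplier P) (mulAll-comm C Oₕ a))) ⟩
      mulAll P (mulAll Oₕ (mulAll C a))
        ≈⟨ ≈⇒≈[] K (mult-cong (mulAll-multiplier P) (factorsUpTo-factorwise squares oddSquare evenSquare
                                                       (λ c k a → ≈-sym (mulAll-++ (evenSquare c k) _ a)) h a)) ⟩
      mulAll P (mulAll (factorsUpTo squares h) a)
        ≡⟨ cong (λ fs → mulAll P (mulAll fs a)) halve ⟨
      mulAll P (mulAll (factorsUpTo evenMinus K) a)
        ≈⟨ ≈⇒≈[] K (factorsUpTo-factorwise evenSquare evenPlus evenMinus evenPlus-evenMinus K a) ⟩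
      mulAll (factorsUpTo evenSquare K) a
        ≈⟨ productUpTo-≈[] _ (λ k → evenSquare-degree (kind k) k) h K h≤K K K<2h+2 a ⟩
      mulAll C a ∎
      where open ≈[]-Reasoning K

  euler-≈[] : ∀ K a → mulAll (factorsUpTo euler K) a ≈[ K ] a
  euler-≈[] K a with parity K
  ... | even h = euler-halving h (h + h) (ℕ.m≤m+n h h) (s≤s (ℕ.+-monoʳ-≤ h (ℕ.n≤1+n h)))
                   (factorsUpTo-evenMinus-double h) a
  ... | odd h  = euler-halving h (suc (h + h)) (ℕ.m≤n⇒m≤1+n (ℕ.m≤m+n h h))
                   (s≤s (ℕ.≤-reflexive (sym (ℕ.+-suc h h))))
                   (factorsUpTo-evenMinus-odd h) a

  -- Generating functions

  -- Qo n r = IsPartition n × QoParts, definitionally.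
  QoParts : List ℕ → Set
  QoParts μ = All (λ y → ¬ (2 * r ∣ y)) μ × Unique (filter (r ∣?_) μ)

  qoParts? : ∀ μ → Dec (QoParts μ)
  qoParts? μ = all? (λ y → ¬? (2 * r ∣? y)) μ ×-dec unique? (filter (r ∣?_) μ)

  qo sgn : List ℕ → ℤ
  qo μ = indicator (qoParts? μ)
  sgn []      = 1ℤ
  sgn (k ∷ μ) = sign (kind k) *ℤ sgn μ

  filter-r∣ : ∀ {k} μ → r ∣ k → filter (r ∣?_) (k ∷ μ) ≡ k ∷ filter (r ∣?_) μ
  filter-r∣ {k} μ r∣k with r ∣? k
  ... | yes _  = refl
  ... | no r∤k = ⊥-elim (r∤k r∣k)

  filter-r∤ : ∀ {k} μ → ¬ r ∣ k → filter (r ∣?_) (k ∷ μ) ≡ filter (r ∣?_) μ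
  filter-r∤ {k} μ r∤k with r ∣? k
  ... | yes r∣k = ⊥-elim (r∤k r∣k)
  ... | no _    = refl

  qo-plain : ∀ {k} μ → kind k ≡ plain → qo (k ∷ μ) ≡ qo μ
  qo-plain {k} μ eq = indicator-⇔ (mk⇔ to from) (qoParts? (k ∷ μ)) (qoParts? μ)
    where
    to : QoParts (k ∷ μ) → QoParts μ
    to (_ ∷ ps , u) = ps , subst Unique (filter-r∤ μ (plain⇒r∤ eq)) u
    from : QoParts μ → QoParts (k ∷ μ)
    from (ps , u) =
      (λ 2r∣k → plain⇒r∤ eq (2r∣⇒r∣ 2r∣k)) ∷ ps , subst Unique (sym (filter-r∤ μ (plain⇒r∤ eq))) u

  qo-oddMult : ∀ {k} μ → kind k ≡ oddMult → k ∉ μ → qo (k ∷ μ) ≡ qo μ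
  qo-oddMult {k} μ eq k∉μ = indicator-⇔ (mk⇔ to from) (qoParts? (k ∷ μ)) (qoParts? μ)
    where
    to : QoParts (k ∷ μ) → QoParts μ
    to (_ ∷ ps , u) with subst Unique (filter-r∣ μ (oddMult⇒r∣ eq)) u
    ... | _ ∷ u′ = ps , u′
    from : QoParts μ → QoParts (k ∷ μ)
    from (ps , u) = oddMult⇒2r∤ eq ∷ ps , subst Unique (sym (filter-r∣ μ (oddMult⇒r∣ eq)))
      (Allₚ.¬Any⇒All¬ (filter (r ∣?_) μ) (λ m → k∉μ (proj₁ (∈-filter⁻ (r ∣?_) m))) ∷ u)

  qo-evenMult : ∀ {k} μ → kind k ≡ evenMult → qo (k ∷ μ) ≡ 0ℤ
  qo-evenMult {k} μ eq = indicator-no (λ { (2r∤k ∷ _ , _) → 2r∤k (evenMult⇒2r∣ eq) }) (qoParts? (k ∷ μ))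

  qo-repeat : ∀ {k} μ → r ∣ k → qo (k ∷ k ∷ μ) ≡ 0ℤ
  qo-repeat {k} μ r∣k = indicator-no repeated (qoParts? (k ∷ k ∷ μ))
    where
    repeated : ¬ QoParts (k ∷ k ∷ μ)
    repeated (_ , u) rewrite filter-r∣ (k ∷ μ) r∣k | filter-r∣ μ r∣k with u
    ... | (k≢k ∷ _) ∷ _ = k≢k refl

  signedGF signedLenGF qoGF qoLenGF : ℕ → Series
  signedGF    = genFun sgn
  signedLenGF = genFun (λ μ → sgn μ *ℤ len μ)
  qoGF        = genFun qo
  qoLenGF     = genFun (λ μ → qo μ *ℤ len μ)

  signedGF-step : ∀ K → mul1+ (- sign (kind (suc K))) (suc K) (signedGF (suc K)) ≈ signedGF K
  signedGF-step K = mul1+-solve₀ (sign (kind (suc K))) (suc K) {b = signedGF K} (genFun-suc sgn K)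
                                 (λ n → ∑-* (sign (kind (suc K))) sgn (partitions (suc K) n))

  signedLenGF-step : ∀ K → let s = sign (kind (suc K)) in
    mul1+ (- s) (suc K) (signedLenGF (suc K)) ≈ signedLenGF K ⊕ s · shift (suc K) (signedGF (suc K))
  signedLenGF-step K =
    ≈-trans (mul1+-solve s (suc K) {b = signedLenGF K} (genFun-suc _ K) tail)
            (λ n → cong (signedLenGF K n +ℤ_) (shift-· (suc K) s (signedGF (suc K)) n))
    where
    s = sign (kind (suc K))
    tail : genFun (λ μ → sgn (suc K ∷ μ) *ℤ len (suc K ∷ μ)) (suc K) ≈
           s · signedLenGF (suc K) ⊕ s · signedGF (suc K)
    tail n = begin
      ∑ (λ μ → (s *ℤ sgn μ) *ℤ (1ℤ +ℤ len μ)) P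
        ≡⟨ ∑-cong P (λ {μ} _ → sgn-len-cons s (sgn μ) (len μ)) ⟩
      ∑ (λ μ → s *ℤ (sgn μ *ℤ len μ) +ℤ s *ℤ sgn μ) P
        ≡⟨ ∑-+ _ _ P ⟩
      ∑ (λ μ → s *ℤ (sgn μ *ℤ len μ)) P +ℤ ∑ (λ μ → s *ℤ sgn μ) P
        ≡⟨ cong₂ _+ℤ_ (∑-* s _ P) (∑-* s sgn P) ⟩
      s *ℤ signedLenGF (suc K) n +ℤ s *ℤ signedGF (suc K) n ∎
      where
      open ≡-Reasoning
      P = partitions (suc K) n
      sgn-len-cons : ∀ s a l → (s *ℤ a) *ℤ (1ℤ +ℤ l) ≡ s *ℤ (a *ℤ l) +ℤ s *ℤ a
      sgn-len-cons = solve-∀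

  genFun-oddMult-tail : ∀ K (v : List ℕ → ℤ) → kind (suc K) ≡ oddMult →
    genFun (λ μ → qo (suc K ∷ μ) *ℤ v μ) (suc K) ≈ genFun (λ μ → qo μ *ℤ v μ) K
  genFun-oddMult-tail K v eq n = begin
    genFun (λ μ → qo (suc K ∷ μ) *ℤ v μ) (suc K) n
      ≡⟨ genFun-suc _ K n ⟩
    genFun (λ μ → qo (suc K ∷ μ) *ℤ v μ) K n +ℤ
      shift (suc K) (genFun (λ μ → qo (suc K ∷ suc K ∷ μ) *ℤ v (suc K ∷ μ)) (suc K)) n
      ≡⟨ cong₂ _+ℤ_ (∑-cong (partitions K n) fresh)
                    (trans (shift-cong (suc K) (λ j → ∑-zero _ (partitions (suc K) j) repeated) n)
                           (shift-𝟘 (suc K) n)) ⟩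
    genFun (λ μ → qo μ *ℤ v μ) K n +ℤ 0ℤ
      ≡⟨ ℤ.+-identityʳ _ ⟩
    genFun (λ μ → qo μ *ℤ v μ) K n ∎
    where
    open ≡-Reasoning
    fresh : ∀ {μ} → μ ∈ partitions K n → qo (suc K ∷ μ) *ℤ v μ ≡ qo μ *ℤ v μ
    fresh {μ} m = cong (_*ℤ v μ) (qo-oddMult μ eq (λ K+1∈μ →
      ℕ.<-irrefl refl (All.lookup (proj₂ (∈-partitionsWith⁻ n K n m)) K+1∈μ)))
    repeated : ∀ μ → qo (suc K ∷ suc K ∷ μ) *ℤ v (suc K ∷ μ) ≡ 0ℤ
    repeated μ = trans (cong (_*ℤ v (suc K ∷ μ)) (qo-repeat μ (oddMult⇒r∣ eq))) (ℤ.*-zeroˡ (v (suc K ∷ μ)))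

  genFun-plain-tail : ∀ K (v : List ℕ → ℤ) → kind (suc K) ≡ plain →
    genFun (λ μ → qo (suc K ∷ μ) *ℤ v μ) (suc K) ≈ genFun (λ μ → qo μ *ℤ v μ) (suc K)
  genFun-plain-tail K v eq n = ∑-cong (partitions (suc K) n) (λ {μ} _ → cong (_*ℤ v μ) (qo-plain μ eq))

  genFun-evenMult-tail : ∀ K (v : List ℕ → ℤ) → kind (suc K) ≡ evenMult →
    genFun (λ μ → qo (suc K ∷ μ) *ℤ v μ) (suc K) ≈ 𝟘
  genFun-evenMult-tail K v eq n =
    ∑-zero _ (partitions (suc K) n) (λ μ → trans (cong (_*ℤ v μ) (qo-evenMult μ eq)) (ℤ.*-zeroˡ (v μ)))

  qoLenGF-cons : ∀ K → genFun (λ μ → qo μ *ℤ (1ℤ +ℤ len μ)) K ≈ qoLenGF K ⊕ qoGF K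
  qoLenGF-cons K n =
    trans (∑-cong (partitions K n) (λ {μ} _ → distrib (qo μ) (len μ))) (∑-+ _ qo (partitions K n))
    where
    distrib : ∀ q l → q *ℤ (1ℤ +ℤ l) ≡ q *ℤ l +ℤ q
    distrib = solve-∀

  qoGF-plain : ∀ K → kind (suc K) ≡ plain → mul1+ -1ℤ (suc K) (qoGF (suc K)) ≈ qoGF K
  qoGF-plain K eq = mul1+-solve₀ 1ℤ (suc K) {b = qoGF K} (genFun-suc qo K) (λ n →
    trans (≈-trans (≈-sym (genFun-*1 _ (suc K))) (≈-trans (genFun-plain-tail K _ eq) (genFun-*1 qo (suc K))) n)
          (sym (ℤ.*-identityˡ _)))

  qoGF-oddMult : ∀ K → kind (suc K) ≡ oddMult → qoGF (suc K) ≈ mul1+ 1ℤ (suc K) (qoGF K)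
  qoGF-oddMult K eq n = trans (genFun-suc qo K n) (cong (qoGF K n +ℤ_) (trans
    (shift-cong (suc K) (≈-trans (≈-sym (genFun-*1 _ (suc K)))
                                 (≈-trans (genFun-oddMult-tail K _ eq) (genFun-*1 qo K))) n)
    (sym (ℤ.*-identityˡ _))))

  qoGF-evenMult : ∀ K → kind (suc K) ≡ evenMult → qoGF (suc K) ≈ qoGF K
  qoGF-evenMult K eq n = trans (genFun-suc qo K n) (trans
    (cong (qoGF K n +ℤ_) (trans (shift-cong (suc K) (≈-trans (≈-sym (genFun-*1 _ (suc K)))
                                                             (genFun-evenMult-tail K _ eq)) n)
                                (shift-𝟘 (suc K) n)))
    (ℤ.+-identityʳ _))

  qoGF-step : ∀ K → mul1+ (- sign (kind (suc K))) (suc K) (qoGF (suc K)) ≈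
                    mulAll (euler (kind (suc K)) (suc K)) (qoGF K)
  qoGF-step K with kind (suc K) in eq
  ... | plain    = qoGF-plain K eq
  ... | oddMult  = begin
    mul1+ -1ℤ k (qoGF (suc K))           ≈⟨ mul1+-cong -1ℤ k (qoGF-oddMult K eq) ⟩
    mul1+ -1ℤ k (mul1+ 1ℤ k (qoGF K))    ≈⟨ mult-mul1+ (mul1+-multiplier -1ℤ k) 1ℤ k (qoGF K) ⟩
    mul1+ 1ℤ k (mul1+ -1ℤ k (qoGF K))    ≈⟨ mul1+-conjugate k (qoGF K) ⟩
    mul1+ -1ℤ (k + k) (qoGF K)           ∎
    where
    open ≈-Reasoning
    k = suc K
  ... | evenMult = mul1+-cong 1ℤ (suc K) (qoGF-evenMult K eq)

  qoLenGF-plain : ∀ K → kind (suc K) ≡ plain →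
    mul1+ -1ℤ (suc K) (qoLenGF (suc K)) ≈ qoLenGF K ⊕ shift (suc K) (qoGF (suc K))
  qoLenGF-plain K eq = mul1+-solve 1ℤ (suc K) {b = qoLenGF K} (genFun-suc _ K) (λ n →
    trans (≈-trans (genFun-plain-tail K (λ μ → 1ℤ +ℤ len μ) eq) (qoLenGF-cons (suc K)) n)
          (cong (_+ℤ qoGF (suc K) n) (sym (ℤ.*-identityˡ (qoLenGF (suc K) n)))))

  qoLenGF-oddMult : ∀ K → kind (suc K) ≡ oddMult →
    qoLenGF (suc K) ≈ mul1+ 1ℤ (suc K) (qoLenGF K) ⊕ shift (suc K) (qoGF K)
  qoLenGF-oddMult K eq n = begin
    qoLenGF (suc K) n
      ≡⟨ genFun-suc _ K n ⟩
    qoLenGF K n +ℤ shift (suc K) (genFun (λ μ → qo (suc K ∷ μ) *ℤ (1ℤ +ℤ len μ)) (suc K)) n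
      ≡⟨ cong (qoLenGF K n +ℤ_) (trans (shift-cong (suc K) (≈-trans (genFun-oddMult-tail K _ eq) (qoLenGF-cons K)) n)
                                       (shift-⊕ (suc K) (qoLenGF K) (qoGF K) n)) ⟩
    qoLenGF K n +ℤ (shift (suc K) (qoLenGF K) n +ℤ shift (suc K) (qoGF K) n)
      ≡⟨ regroup (qoLenGF K n) _ _ ⟩
    qoLenGF K n +ℤ 1ℤ *ℤ shift (suc K) (qoLenGF K) n +ℤ shift (suc K) (qoGF K) n ∎
    where
    open ≡-Reasoning
    regroup : ∀ x y z → x +ℤ (y +ℤ z) ≡ x +ℤ 1ℤ *ℤ y +ℤ z
    regroup = solve-∀

  qoLenGF-evenMult : ∀ K → kind (suc K) ≡ evenMult → qoLenGF (suc K) ≈ qoLenGF K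
  qoLenGF-evenMult K eq n = trans (genFun-suc _ K n) (trans
    (cong (qoLenGF K n +ℤ_) (trans (shift-cong (suc K) (genFun-evenMult-tail K _ eq) n) (shift-𝟘 (suc K) n)))
    (ℤ.+-identityʳ _))

  signed : Kind → ℕ → List Factor
  signed c k = (- sign c , k) ∷ []

  signed-telescope : ∀ (A : ℕ → Series) (g : ℕ → List Factor) →
    (∀ K → mul1+ (- sign (kind (suc K))) (suc K) (A (suc K)) ≈ mulAll (g (suc K)) (A K)) →
    ∀ K → mulAll (factorsUpTo signed K) (A K) ≈ mulAll (productUpTo g K) (A 0)
  signed-telescope A g step zero n = refl
  signed-telescope A g step (suc K) = begin
    mulAll S (mul1+ (- sign (kind (suc K))) (suc K) (A (suc K)))
      ≈⟨ mult-cong (mulAll-multiplier S) (step K) ⟩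
    mulAll S (mulAll (g (suc K)) (A K))
      ≈⟨ mulAll-comm S (g (suc K)) (A K) ⟩
    mulAll (g (suc K)) (mulAll S (A K))
      ≈⟨ mult-cong (mulAll-multiplier (g (suc K))) (signed-telescope A g step K) ⟩
    mulAll (g (suc K)) (mulAll (productUpTo g K) (A 0))
      ≈⟨ mulAll-comm (g (suc K)) (productUpTo g K) (A 0) ⟩
    mulAll (productUpTo g K) (mulAll (g (suc K)) (A 0))
      ≈⟨ mulAll-++ (g (suc K)) _ _ ⟨
    mulAll (productUpTo g (suc K)) (A 0) ∎
    where
    open ≈-Reasoning
    S = factorsUpTo signed K

  signedGF-closed : ∀ K → mulAll (factorsUpTo signed K) (signedGF K) ≈ 𝟙
  signedGF-closed K = ≈-trans (signed-telescope signedGF (λ _ → []) signedGF-step K)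
                              (λ n → trans (cong (λ fs → mulAll fs (signedGF 0) n) (productUpTo-[] K)) (initial n))
    where
    initial : signedGF 0 ≈ 𝟙
    initial zero    = refl
    initial (suc n) = refl

  qoGF-closed : ∀ K → mulAll (factorsUpTo signed K) (qoGF K) ≈ mulAll (factorsUpTo euler K) 𝟙
  qoGF-closed K = ≈-trans (signed-telescope qoGF (λ k → euler (kind k) k) qoGF-step K)
                          (mult-cong (mulAll-multiplier (factorsUpTo euler K)) initial)
    where
    initial : qoGF 0 ≈ 𝟙
    initial zero    = refl
    initial (suc n) = refl

  signedGF-≈[]-qoGF : ∀ K → signedGF K ≈[ K ] qoGF K
  signedGF-≈[]-qoGF K = mulAll-cancel[] S K (productUpTo-positive _ (λ k → s≤s z≤n ∷ []) K) (begin
    mulAll S (signedGF K)              ≈⟨ ≈⇒≈[] K (signedGF-closed K) ⟩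
    𝟙                                  ≈⟨ euler-≈[] K 𝟙 ⟨
    mulAll (factorsUpTo euler K) 𝟙     ≈⟨ ≈⇒≈[] K (qoGF-closed K) ⟨
    mulAll S (qoGF K)                  ∎)
    where
    open ≈[]-Reasoning K
    S = factorsUpTo signed K

  logTerm : ℕ → Series → Series
  logTerm zero    a = 𝟘
  logTerm (suc k) a = sign (kind (suc k)) · frac (sign (kind (suc k))) k a

  qoTerm : Kind → ℕ → Series → Series
  qoTerm plain    k a = frac 1ℤ k a
  qoTerm oddMult  k a = frac -1ℤ k a
  qoTerm evenMult k a = 𝟘

  qoLogTerm : ℕ → Series → Series
  qoLogTerm zero    a = 𝟘
  qoLogTerm (suc k) a = qoTerm (kind (suc k)) k a

  logTerm-multiplier : ∀ k → IsMultiplier (logTerm k)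
  logTerm-multiplier zero    = 𝟘-multiplier
  logTerm-multiplier (suc k) = ·-multiplier (sign (kind (suc k))) (frac-multiplier (sign (kind (suc k))) k)

  qoLogTerm-multiplier : ∀ k → IsMultiplier (qoLogTerm k)
  qoLogTerm-multiplier zero = 𝟘-multiplier
  qoLogTerm-multiplier (suc k) with kind (suc k)
  ... | plain    = frac-multiplier 1ℤ k
  ... | oddMult  = frac-multiplier -1ℤ k
  ... | evenMult = 𝟘-multiplier

  logSum qoLogSum : ℕ → Series → Series
  logSum   = sumUpTo logTerm
  qoLogSum = sumUpTo qoLogTerm

  logSum-multiplier : ∀ K → IsMultiplier (logSum K)
  logSum-multiplier = sumUpTo-multiplier logTerm logTerm-multiplier

  qoLogSum-multiplier : ∀ K → IsMultiplier (qoLogSum K)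
  qoLogSum-multiplier = sumUpTo-multiplier qoLogTerm qoLogTerm-multiplier

  -- A logarithmic derivative: the parts equal to k contribute s xᵏ/(1 - s xᵏ) to the length.
  signedLenGF-closed : ∀ K → signedLenGF K ≈ logSum K (signedGF K)
  signedLenGF-closed zero    zero    = refl
  signedLenGF-closed zero    (suc n) = refl
  signedLenGF-closed (suc K) = ≈-sym (mul1+-cancel (- s) K (begin
    mul1+ (- s) (suc K) (logSum K W′ ⊕ logTerm (suc K) W′)
      ≈⟨ mult-⊕ (mul1+-multiplier (- s) (suc K)) (logSum K W′) _ ⟩
    mul1+ (- s) (suc K) (logSum K W′) ⊕ mul1+ (- s) (suc K) (s · frac s K W′)
      ≈⟨ ⊕-cong (≈-sym (mult-mul1+ (logSum-multiplier K) (- s) (suc K) W′))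
                (≈-trans (mult-· (mul1+-multiplier (- s) (suc K)) s _) (·-cong s (mul1+-frac s K W′))) ⟩
    logSum K (mul1+ (- s) (suc K) W′) ⊕ s · shift (suc K) W′
      ≈⟨ ⊕-congˡ (s · shift (suc K) W′) (mult-cong (logSum-multiplier K) (signedGF-step K)) ⟩
    logSum K (signedGF K) ⊕ s · shift (suc K) W′
      ≈⟨ ⊕-congˡ (s · shift (suc K) W′) (signedLenGF-closed K) ⟨
    signedLenGF K ⊕ s · shift (suc K) W′
      ≈⟨ signedLenGF-step K ⟨
    mul1+ (- s) (suc K) (signedLenGF (suc K)) ∎))
    where
    open ≈-Reasoning
    s  = sign (kind (suc K))
    W′ = signedGF (suc K)

  qoLenGF-closed-plain : ∀ K → kind (suc K) ≡ plain → qoLenGF K ≈ qoLogSum K (qoGF K) →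
                         qoLenGF (suc K) ≈ qoLogSum K (qoGF (suc K)) ⊕ frac 1ℤ K (qoGF (suc K))
  qoLenGF-closed-plain K eq ih = ≈-sym (mul1+-cancel -1ℤ K (begin
    mul1+ -1ℤ k (qoLogSum K Q′ ⊕ frac 1ℤ K Q′)
      ≈⟨ mult-⊕ (mul1+-multiplier -1ℤ k) (qoLogSum K Q′) _ ⟩
    mul1+ -1ℤ k (qoLogSum K Q′) ⊕ mul1+ -1ℤ k (frac 1ℤ K Q′)
      ≈⟨ ⊕-cong (≈-sym (mult-mul1+ (qoLogSum-multiplier K) -1ℤ k Q′)) (mul1+-frac 1ℤ K Q′) ⟩
    qoLogSum K (mul1+ -1ℤ k Q′) ⊕ shift k Q′
      ≈⟨ ⊕-congˡ (shift k Q′) (≈-trans (mult-cong (qoLogSum-multiplier K) (qoGF-plain K eq)) (≈-sym ih)) ⟩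
    qoLenGF K ⊕ shift k Q′
      ≈⟨ qoLenGF-plain K eq ⟨
    mul1+ -1ℤ k (qoLenGF (suc K)) ∎))
    where
    open ≈-Reasoning
    k  = suc K
    Q′ = qoGF (suc K)

  qoLenGF-closed-oddMult : ∀ K → kind (suc K) ≡ oddMult → qoLenGF K ≈ qoLogSum K (qoGF K) →
                           qoLenGF (suc K) ≈ qoLogSum K (qoGF (suc K)) ⊕ frac -1ℤ K (qoGF (suc K))
  qoLenGF-closed-oddMult K eq ih = begin
    qoLenGF (suc K)
      ≈⟨ qoLenGF-oddMult K eq ⟩
    mul1+ 1ℤ k (qoLenGF K) ⊕ shift k (qoGF K)
      ≈⟨ ⊕-cong (mul1+-cong 1ℤ k ih) (shift-cong k (≈-sym (recip-mul1+ -1ℤ K (qoGF K)))) ⟩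
    mul1+ 1ℤ k (qoLogSum K (qoGF K)) ⊕ frac -1ℤ K (mul1+ 1ℤ k (qoGF K))
      ≈⟨ ⊕-cong (mult-mul1+ (qoLogSum-multiplier K) 1ℤ k (qoGF K))
                (mult-cong (frac-multiplier -1ℤ K) (qoGF-oddMult K eq)) ⟨
    qoLogSum K (mul1+ 1ℤ k (qoGF K)) ⊕ frac -1ℤ K (qoGF (suc K))
      ≈⟨ ⊕-congˡ (frac -1ℤ K (qoGF (suc K))) (mult-cong (qoLogSum-multiplier K) (qoGF-oddMult K eq)) ⟨
    qoLogSum K (qoGF (suc K)) ⊕ frac -1ℤ K (qoGF (suc K)) ∎
    where
    open ≈-Reasoning
    k = suc K

  qoLenGF-closed-evenMult : ∀ K → kind (suc K) ≡ evenMult → qoLenGF K ≈ qoLogSum K (qoGF K) →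
                            qoLenGF (suc K) ≈ qoLogSum K (qoGF (suc K)) ⊕ 𝟘
  qoLenGF-closed-evenMult K eq ih n = begin
    qoLenGF (suc K) n                        ≡⟨ qoLenGF-evenMult K eq n ⟩
    qoLenGF K n                              ≡⟨ ih n ⟩
    qoLogSum K (qoGF K) n                    ≡⟨ mult-cong (qoLogSum-multiplier K) (qoGF-evenMult K eq) n ⟨
    qoLogSum K (qoGF (suc K)) n              ≡⟨ ℤ.+-identityʳ _ ⟨
    qoLogSum K (qoGF (suc K)) n +ℤ 0ℤ        ∎
    where open ≡-Reasoning

  qoLenGF-closed : ∀ K → qoLenGF K ≈ qoLogSum K (qoGF K)
  qoLenGF-closed zero    zero    = refl
  qoLenGF-closed zero    (suc n) = refl
  qoLenGF-closed (suc K) with kind (suc K) in eq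
  ... | plain    = qoLenGF-closed-plain K eq (qoLenGF-closed K)
  ... | oddMult  = qoLenGF-closed-oddMult K eq (qoLenGF-closed K)
  ... | evenMult = qoLenGF-closed-evenMult K eq (qoLenGF-closed K)

  evenGeom doubleGeom : Kind → ℕ → Series → Series
  evenGeom evenMult k a = geom k a
  evenGeom _        k a = 𝟘
  doubleGeom plain k a = 𝟘
  doubleGeom _     k a = geom (k + k) a

  kindSum : (Kind → ℕ → Series → Series) → ℕ → Series → Series
  kindSum t = sumUpTo (λ k → t (kind k) k)

  logTerm-qoLogTerm : ∀ k a → logTerm (suc k) a ⊝ qoLogTerm (suc k) a ≈
                      + 2 · doubleGeom (kind (suc k)) (suc k) a ⊝ evenGeom (kind (suc k)) (suc k) a
  logTerm-qoLogTerm k a n with kind (suc k)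
  ... | plain    = cancel (frac 1ℤ k a n)
    where
    cancel : ∀ x → 1ℤ *ℤ x - x ≡ + 2 *ℤ 0ℤ - 0ℤ
    cancel = solve-∀
  ... | oddMult  = trans (cong (_- frac -1ℤ k a n) (ℤ.*-identityˡ (frac 1ℤ k a n)))
                         (trans (frac-difference k a n) (sym (ℤ.+-identityʳ _)))
  ... | evenMult = rearrange (frac 1ℤ k a n) (frac -1ℤ k a n) _ (frac-difference k a n)
    where
    rearrange : ∀ x y z → x - y ≡ z → -1ℤ *ℤ y - 0ℤ ≡ z - x
    rearrange x y z e = trans (identity x y) (cong (_- x) e)
      where
      identity : ∀ x y → -1ℤ *ℤ y - 0ℤ ≡ (x - y) - x
      identity = solve-∀

  doubleGeom-evenGeom : ∀ k a → doubleGeom (kind k) k a ≈ evenGeom (kind (k + k)) (k + k) a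
  doubleGeom-evenGeom k a with kind k in eq
  ... | oddMult  rewrite kind-double-oddMult eq = λ n → refl
  ... | evenMult rewrite kind-double-evenMult eq = λ n → refl
  ... | plain with kind (k + k) in eq₂
  ...   | plain    = λ n → refl
  ...   | oddMult  = λ n → refl
  ...   | evenMult = ⊥-elim (kind-double-plain eq eq₂)

  evenGeom-odd : ∀ h a → evenGeom (kind (suc (h + h))) (suc (h + h)) a ≈ 𝟘
  evenGeom-odd h a with kind (suc (h + h)) in eq
  ... | plain    = λ n → refl
  ... | oddMult  = λ n → refl
  ... | evenMult = ⊥-elim (kind-odd h eq)

  kindSum-doubleGeom : ∀ K a → kindSum doubleGeom K a ≈ kindSum evenGeom (K + K) a
  kindSum-doubleGeom zero    a n = refl
  kindSum-doubleGeom (suc K) a n = begin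
    kindSum doubleGeom K a n +ℤ doubleGeom (kind (suc K)) (suc K) a n
      ≡⟨ cong₂ _+ℤ_ (kindSum-doubleGeom K a n) (doubleGeom-evenGeom (suc K) a n) ⟩
    kindSum evenGeom (K + K) a n +ℤ evenGeom (kind (suc K + suc K)) (suc K + suc K) a n
      ≡⟨ cong (_+ℤ evenGeom (kind (suc K + suc K)) (suc K + suc K) a n) (begin
           kindSum evenGeom (K + K) a n
             ≡⟨ ℤ.+-identityʳ _ ⟨
           kindSum evenGeom (K + K) a n +ℤ 0ℤ
             ≡⟨ cong (kindSum evenGeom (K + K) a n +ℤ_) (evenGeom-odd K a n) ⟨
           kindSum evenGeom (suc (K + K)) a n
             ≡⟨ cong (λ m → kindSum evenGeom m a n) (ℕ.+-suc K K) ⟨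
           kindSum evenGeom (K + suc K) a n ∎) ⟩
    kindSum evenGeom (suc K + suc K) a n ∎
    where open ≡-Reasoning

  logSum-qoLogSum-≈[] : ∀ K a → logSum K a ⊝ qoLogSum K a ≈[ K ] kindSum evenGeom K a
  logSum-qoLogSum-≈[] K a n n≤K = begin
    logSum K a n - qoLogSum K a n
      ≡⟨ sumUpTo-⊝ logTerm qoLogTerm _ _ (+ 2) logTerm-qoLogTerm K a n ⟩
    + 2 *ℤ kindSum doubleGeom K a n - F K a n
      ≡⟨ cong (λ x → + 2 *ℤ x - F K a n) (trans (kindSum-doubleGeom K a n) (truncate n n≤K)) ⟩
    + 2 *ℤ F K a n - F K a n
      ≡⟨ twice-minus-once (F K a n) ⟩
    F K a n ∎
    where
    open ≡-Reasoning
    F = kindSum evenGeom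
    twice-minus-once : ∀ x → + 2 *ℤ x - x ≡ x
    twice-minus-once = solve-∀
    truncate : F (K + K) a ≈[ K ] F K a
    truncate = sumUpTo-≈[] _ K K (K + K) a (ℕ.m≤m+n K K) small
      where
      small : ∀ k → K < k → evenGeom (kind k) k a ≈[ K ] 𝟘
      small (suc k) K<k with kind (suc k)
      ... | plain    = λ n p → refl
      ... | oddMult  = λ n p → refl
      ... | evenMult = shift-≈[]𝟘 (suc k) _ K K<k

  sgn-countDiv : ∀ μ → sgn μ ≡ -1ℤ ^ countDiv (2 * r) μ
  sgn-countDiv []       = refl
  sgn-countDiv (y ∷ ys) with 2 * r ∣? y
  ... | yes d = cong (-1ℤ *ℤ_) (sgn-countDiv ys)
  ... | no _ with r ∣? y
  ...   | yes _ = trans (ℤ.*-identityˡ (sgn ys)) (sgn-countDiv ys)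
  ...   | no _  = trans (ℤ.*-identityˡ (sgn ys)) (sgn-countDiv ys)

  even? : ∀ μ → Dec (countDiv (2 * r) μ % 2 ≡ 0)
  even? μ = countDiv (2 * r) μ % 2 ℕ.≟ 0

  odd? : ∀ μ → Dec (countDiv (2 * r) μ % 2 ≡ 1)
  odd? μ = countDiv (2 * r) μ % 2 ℕ.≟ 1

  parity-difference : ∀ μ → indicator (even? μ) *ℤ len μ - indicator (odd? μ) *ℤ len μ ≡ sgn μ *ℤ len μ
  parity-difference μ with -1^-parity (countDiv (2 * r) μ) | even? μ | odd? μ
  ... | inj₁ (_ , e)   | yes _ | no _  = trans (evenCase (len μ)) (cong (_*ℤ len μ) (sym (trans (sgn-countDiv μ) e)))
    where
    evenCase : ∀ y → 1ℤ *ℤ y - 0ℤ *ℤ y ≡ 1ℤ *ℤ y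
    evenCase = solve-∀
  ... | inj₂ (_ , e)   | no _  | yes _ = trans (oddCase (len μ)) (cong (_*ℤ len μ) (sym (trans (sgn-countDiv μ) e)))
    where
    oddCase : ∀ y → 0ℤ *ℤ y - 1ℤ *ℤ y ≡ -1ℤ *ℤ y
    oddCase = solve-∀
  ... | inj₁ (c%2 , _) | no ¬c%2 | _      = ⊥-elim (¬c%2 c%2)
  ... | inj₁ (c%2 , _) | _      | yes c%2′ = ⊥-elim (ℕ.0≢1+n (trans (sym c%2) c%2′))
  ... | inj₂ (c%2 , _) | _      | no ¬c%2 = ⊥-elim (¬c%2 c%2)
  ... | inj₂ (c%2 , _) | yes c%2′ | _     = ⊥-elim (ℕ.0≢1+n (trans (sym c%2′) c%2))

  sumℓ-difference : ∀ n {Le Lo Lq} → Enumerates Le (Pe n r) → Enumerates Lo (Po n r) → Enumerates Lq (Qo n r) →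
                    + sumℓ Le - + sumℓ Lo - + sumℓ Lq ≡ signedLenGF n n - qoLenGF n n
  sumℓ-difference n {Le} {Lo} ee eo eq = cong₂ _-_ (begin
    + sumℓ Le - + sumℓ Lo
      ≡⟨ cong₂ _-_ (sumℓ-enumerates n even? ee) (sumℓ-enumerates n odd? eo) ⟩
    ∑ (λ μ → indicator (even? μ) *ℤ len μ) P - ∑ (λ μ → indicator (odd? μ) *ℤ len μ) P
      ≡⟨ ∑-difference _ _ P ⟨
    ∑ (λ μ → indicator (even? μ) *ℤ len μ - indicator (odd? μ) *ℤ len μ) P
      ≡⟨ ∑-cong P (λ {μ} _ → parity-difference μ) ⟩
    signedLenGF n n ∎) (sumℓ-enumerates n qoParts? eq)
    where
    open ≡-Reasoning
    P = partitions n n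

  lenGF-difference : ∀ K → signedLenGF K K - qoLenGF K K ≡ kindSum evenGeom K (qoGF K) K
  lenGF-difference K = begin
    signedLenGF K K - qoLenGF K K
      ≡⟨ cong₂ _-_ (trans (signedLenGF-closed K K)
                           (mult-cong[] (logSum-multiplier K) K (signedGF-≈[]-qoGF K) K ℕ.≤-refl))
                    (qoLenGF-closed K K) ⟩
    logSum K (qoGF K) K - qoLogSum K (qoGF K) K
      ≡⟨ logSum-qoLogSum-≈[] K (qoGF K) K ℕ.≤-refl ⟩
    kindSum evenGeom K (qoGF K) K ∎
    where open ≡-Reasoning

  -- Counting the pairs

  pairBlock : ℕ → ℕ → ℕ → List (List ℕ × ℕ × ℕ)
  pairBlock n a b = guard (2 * r ∣? a) (guard (a * b ≤? n)
    (map (λ μ → μ , a , b) (filter qoParts? (partitions n (n ∸ a * b)))))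

  pairList : ℕ → List (List ℕ × ℕ × ℕ)
  pairList n = concatMap (λ a → concatMap (pairBlock n a) (oneTo n)) (oneTo n)

  ∈-pairBlock⁻ : ∀ {n a b y} → y ∈ pairBlock n a b →
    2 * r ∣ a × a * b ≤ n × ∃ λ μ → μ ∈ filter qoParts? (partitions n (n ∸ a * b)) × y ≡ (μ , a , b)
  ∈-pairBlock⁻ {n} {a} {b} m with 2 * r ∣? a | a * b ≤? n
  ... | yes 2r∣a | yes ab≤n with ∈-map⁻ (λ μ → μ , a , b) m
  ...   | μ , m′ , refl = 2r∣a , ab≤n , μ , m′ , refl

  ∈-pairBlock⁺ : ∀ {n a b μ} → 2 * r ∣ a → a * b ≤ n →
                 μ ∈ filter qoParts? (partitions n (n ∸ a * b)) → (μ , a , b) ∈ pairBlock n a b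
  ∈-pairBlock⁺ {n} {a} {b} 2r∣a ab≤n m with 2 * r ∣? a | a * b ≤? n
  ... | yes _ | yes _    = ∈-map⁺ (λ μ → μ , a , b) m
  ... | no ¬d | _        = ⊥-elim (¬d 2r∣a)
  ... | yes _ | no ab≰n  = ⊥-elim (ab≰n ab≤n)

  pairList-enumerates : ∀ n → Enumerates (pairList n) (PairSet n r)
  pairList-enumerates n = unique , λ y → sound y , complete y
    where
    unique : Unique (pairList n)
    unique = concatMap-unique _ (λ y → proj₁ (proj₂ y)) (oneTo-unique n)
      (λ a → concatMap-unique _ (λ y → proj₂ (proj₂ y)) (oneTo-unique n)
        (λ b → guard-unique (2 * r ∣? a) (guard-unique (a * b ≤? n)
                 (Uniqueₚ.map⁺ (cong proj₁) (Uniqueₚ.filter⁺ qoParts? (partitionsWith-unique _ n _)))))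
        (λ {b} m → let (_ , _ , _ , _ , eq) = ∈-pairBlock⁻ {n} {a} {b} m in cong (λ y → proj₂ (proj₂ y)) eq))
      (λ {a} m → let (b , _ , m′) = find (∈-concatMap⁻ (pairBlock n a) {xs = oneTo n} m)
                     (_ , _ , _ , _ , eq) = ∈-pairBlock⁻ {n} {a} {b} m′
                 in cong (λ y → proj₁ (proj₂ y)) eq)
    sound : ∀ y → y ∈ pairList n → PairSet n r y
    sound y m with find (∈-concatMap⁻ (λ a → concatMap (pairBlock n a) (oneTo n)) {xs = oneTo n} m)
    ... | a , a∈ , m₁ with find (∈-concatMap⁻ (pairBlock n a) {xs = oneTo n} m₁)
    ... | b , b∈ , m₂ with ∈-pairBlock⁻ {n} {a} {b} m₂
    ... | 2r∣a , ab≤n , μ , m₃ , refl = let (μ∈ , qoμ) = ∈-filter⁻ qoParts? m₃ in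
      proj₁ (∈-oneTo⁻ a∈) , proj₁ (∈-oneTo⁻ b∈) , 2r∣a , ab≤n ,
      proj₁ (∈-partitionsWith⁻ _ n _ μ∈) , qoμ
    complete : ∀ y → PairSet n r y → y ∈ pairList n
    complete (μ , a , b) (1≤a , 1≤b , 2r∣a , ab≤n , isPart , qoμ) =
      ∈-concatMap⁺ _ (lose (∈-oneTo⁺ 1≤a (ℕ.≤-trans (ℕ.m≤m*n a b ⦃ >-nonZero 1≤b ⦄) ab≤n))
      (∈-concatMap⁺ _ (lose (∈-oneTo⁺ 1≤b (ℕ.≤-trans (ℕ.m≤n*m b a ⦃ >-nonZero 1≤a ⦄) ab≤n))
      (∈-pairBlock⁺ 2r∣a ab≤n (∈-filter⁺ qoParts? (∈-partitions n isPart (ℕ.m∸n≤m n (a * b))) qoμ)))))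

  evenGeom-indicator : ∀ a q → evenGeom (kind a) a q ≈ indicator (2 * r ∣? a) · geom a q
  evenGeom-indicator a q n with 2 * r ∣? a
  ... | yes _ = sym (ℤ.*-identityˡ (geom a q n))
  ... | no _ with r ∣? a
  ...   | yes _ = sym (ℤ.*-zeroˡ (geom a q n))
  ...   | no _  = sym (ℤ.*-zeroˡ (geom a q n))

  +length-pairBlock : ∀ n a b → + length (pairBlock n a b) ≡ indicator (2 * r ∣? a) *ℤ shift (a * b) (qoGF n) n
  +length-pairBlock n a b = begin
    + length (pairBlock n a b)
      ≡⟨ +length-guard (2 * r ∣? a) _ ⟩
    ind *ℤ + length (guard (a * b ≤? n) (map (λ μ → μ , a , b) Qs))
      ≡⟨ cong (ind *ℤ_) (+length-guard (a * b ≤? n) _) ⟩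
    ind *ℤ (indicator (a * b ≤? n) *ℤ + length (map (λ μ → μ , a , b) Qs))
      ≡⟨ cong (λ x → ind *ℤ (indicator (a * b ≤? n) *ℤ x)) count ⟩
    ind *ℤ (indicator (a * b ≤? n) *ℤ qoGF n (n ∸ a * b))
      ≡⟨ cong (ind *ℤ_) (indicator-shift (a * b) (qoGF n) n) ⟩
    ind *ℤ shift (a * b) (qoGF n) n ∎
    where
    open ≡-Reasoning
    ind = indicator (2 * r ∣? a)
    P   = partitions n (n ∸ a * b)
    Qs  = filter qoParts? P
    count : + length (map (λ μ → μ , a , b) Qs) ≡ qoGF n (n ∸ a * b)
    count = begin
      + length (map (λ μ → μ , a , b) Qs)  ≡⟨ cong +_ (List.length-map _ Qs) ⟩
      + length Qs                          ≡⟨ +length Qs ⟩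
      ∑ (λ _ → 1ℤ) Qs                      ≡⟨ ∑-indicator qoParts? (λ _ → 1ℤ) P ⟩
      ∑ (λ μ → qo μ *ℤ 1ℤ) P               ≡⟨ genFun-*1 qo n (n ∸ a * b) ⟩
      qoGF n (n ∸ a * b)                   ∎

  +length-pairList : ∀ n → + length (pairList n) ≡ kindSum evenGeom n (qoGF n) n
  +length-pairList n = begin
    + length (pairList n)
      ≡⟨ +length-concatMap _ (oneTo n) ⟩
    ∑ (λ a → + length (concatMap (pairBlock n a) (oneTo n))) (oneTo n)
      ≡⟨ ∑-cong (oneTo n) (λ a∈ → block (proj₁ (∈-oneTo⁻ a∈))) ⟩
    ∑ (λ a → evenGeom (kind a) a Q n) (oneTo n)
      ≡⟨ sumUpTo-∑ _ n Q n ⟨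
    kindSum evenGeom n Q n ∎
    where
    open ≡-Reasoning
    Q = qoGF n
    block : ∀ {a} → 1 ≤ a → + length (concatMap (pairBlock n a) (oneTo n)) ≡ evenGeom (kind a) a Q n
    block {suc j} _ = begin
      + length (concatMap (pairBlock n a) (oneTo n))
        ≡⟨ +length-concatMap _ (oneTo n) ⟩
      ∑ (λ b → + length (pairBlock n a b)) (oneTo n)
        ≡⟨ ∑-cong (oneTo n) (λ {b} _ → +length-pairBlock n a b) ⟩
      ∑ (λ b → ind *ℤ shift (a * b) Q n) (oneTo n)
        ≡⟨ ∑-* ind (λ b → shift (a * b) Q n) (oneTo n) ⟩
      ind *ℤ ∑ (λ b → shift (a * b) Q n) (oneTo n)
        ≡⟨ cong (ind *ℤ_) (sumUpTo-∑ (λ b → shift (a * b)) n Q n) ⟨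
      ind *ℤ sumUpTo (λ b → shift (a * b)) n Q n
        ≡⟨ cong (ind *ℤ_) (geom-≈[]-sumUpTo j Q n n ℕ.≤-refl) ⟨
      ind *ℤ geom a Q n
        ≡⟨ evenGeom-indicator a Q n ⟨
      evenGeom (kind a) a Q n ∎
      where
      a = suc j
      ind = indicator (2 * r ∣? a)

  pairs-count : ∀ n {L} → Enumerates L (PairSet n r) → + length L ≡ kindSum evenGeom n (qoGF n) n
  pairs-count n enum =
    trans (cong +_ (↭.↭-length (Enumerates-↭ enum (pairList-enumerates n)))) (+length-pairList n)

theorem1p5 : (r n : ℕ) → 1 ≤ r →
    (Le Lo Lq : List (List ℕ)) (Lpairs : List (List ℕ × ℕ × ℕ)) →
    Enumerates Le (Pe n r) → Enumerates Lo (Po n r) → Enumerates Lq (Qo n r) →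
    Enumerates Lpairs (PairSet n r) →
    (+ sumℓ Le) - (+ sumℓ Lo) - (+ sumℓ Lq) ≡ + length Lpairs
theorem1p5 r n _ Le Lo Lq Lpairs ee eo eq ep = begin
  + sumℓ Le - + sumℓ Lo - + sumℓ Lq      ≡⟨ sumℓ-difference n ee eo eq ⟩
  signedLenGF n n - qoLenGF n n          ≡⟨ lenGF-difference n ⟩
  kindSum evenGeom n (qoGF n) n          ≡⟨ pairs-count n ep ⟨
  + length Lpairs                        ∎
  where
  open Modulus r
  open ≡-Reasoning
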